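{- Let $m\in\{2,3,4\}$ and let $G$ be a finite Abelian group such that $\mathcal{L}(G)$ is well-rounded and $d(G)=2$. Then $\mathcal{L}(\mathbb{Z}_m\times G)$ is well-rounded and $d(\mathbb{Z}_m\times G)=2$.
   Context: For a finite Abelian (additive) group $G=\{0,g_1,\dots,g_n\}$ of order $n+1$ with nonzero elements listed as $g_1,\dots,g_n$, define $$\mathcal{L}(G)=\Big\{X=(x_1,\dots,x_n,-x_1-\cdots-x_n)\in\mathbb{Z}^{n+1}:\ x_1g_1+\cdots+x_ng_n=0\Big\},$$ a lattice of rank $n$. Let $d(G)=\min\{\|X\|: X\in\mathcal{L}(G)\setminus\{0\}\}$ (Euclidean norm) and call the vectors of $\mathcal{L}(G)$ of norm $d(G)$ minimal vectors. $\mathcal{L}(G)$ is well-rounded if it contains $n$ linearly independent minimal vectors. $\mathbb{Z}_m$ is the cyclic group of order $m$. -}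

module Defs where

open import Level using (0ℓ)
open import Algebra.Bundles using (AbelianGroup)
open import Algebra.Construct.DirectProduct using (abelianGroup)
open import Data.Nat using (ℕ; zero; suc)
open import Data.Integer using (ℤ; +_; -[1+_]; _+_; _-_; -_; _*_; 0ℤ)
open import Data.Integer.Divisibility.Signed using (_∣_; divides; ∣m∣n⇒∣m+n; ∣m⇒∣-m)
open import Data.Integer.Tactic.RingSolver using (solve-∀)
open import Data.Fin using (Fin; zero; suc; fromℕ; inject₁)
open import Data.Product using (Σ; ∃; _×_; _,_)
open import Relation.Nullary using (¬_)
open import Relation.Binary.PropositionalEquality using (_≡_; refl; sym; trans; subst; cong)

-- The cyclic group ℤ_m, realised as ℤ with equality "congruence mod m".

private
  resp : ∀ {k a b} → a ≡ b → k ∣ a → k ∣ b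
  resp refl p = p

  lem-sym : ∀ x y → - (x - y) ≡ y - x
  lem-sym = solve-∀

  lem-trans : ∀ x y z → (x - y) + (y - z) ≡ x - z
  lem-trans = solve-∀

  lem-cong : ∀ x y u v → (x - y) + (u - v) ≡ (x + u) - (y + v)
  lem-cong = solve-∀

  lem-neg : ∀ x y → - (x - y) ≡ (- x) - (- y)
  lem-neg = solve-∀

  lem-refl : ∀ x → 0ℤ ≡ (x - x)
  lem-refl = solve-∀

  lem-eq : ∀ x y → x ≡ y → 0ℤ ≡ x - y
  lem-eq x .x refl = lem-refl x

  ≡⇒cong : ∀ m {x y} → x ≡ y → (+ m) ∣ (x - y)
  ≡⇒cong m {x} {y} e = divides 0ℤ (trans (sym (lem-eq x y e)) (sym (lem0 (+ m))))
    where
    lem0 : ∀ a → 0ℤ * a ≡ 0ℤ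
    lem0 = solve-∀

_≡[mod_]_ : ℤ → ℕ → ℤ → Set
x ≡[mod m ] y = (+ m) ∣ (x - y)

ℤ/ : ℕ → AbelianGroup 0ℓ 0ℓ
ℤ/ m = record
  { Carrier = ℤ
  ; _≈_ = λ x y → x ≡[mod m ] y
  ; _∙_ = _+_
  ; ε = 0ℤ
  ; _⁻¹ = -_
  ; isAbelianGroup = record
    { isGroup = record
      { isMonoid = record
        { isSemigroup = record
          { isMagma = record
            { isEquivalence = record
              { refl = λ {x} → ≡⇒cong m {x} refl
              ; sym = λ {x} {y} p → resp (lem-sym x y) (∣m⇒∣-m p)
              ; trans = λ {x} {y} {z} p q → resp (lem-trans x y z) (∣m∣n⇒∣m+n p q)
              }
            ; ∙-cong = λ {x} {y} {u} {v} p q → resp (lem-cong x y u v) (∣m∣n⇒∣m+n p q)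
            }
          ; assoc = λ x y z → ≡⇒cong m (Data.Integer.Properties.+-assoc x y z)
          }
        ; identity = (λ x → ≡⇒cong m (Data.Integer.Properties.+-identityˡ x))
                   , (λ x → ≡⇒cong m (Data.Integer.Properties.+-identityʳ x))
        }
      ; inverse = (λ x → ≡⇒cong m (Data.Integer.Properties.+-inverseˡ x))
                , (λ x → ≡⇒cong m (Data.Integer.Properties.+-inverseʳ x))
      ; ⁻¹-cong = λ {x} {y} p → resp (lem-neg x y) (∣m⇒∣-m p)
      }
    ; comm = λ x y → ≡⇒cong m (Data.Integer.Properties.+-comm x y)
    }
  }
  where import Data.Integer.Properties

_⊗_ : ℕ → AbelianGroup 0ℓ 0ℓ → AbelianGroup 0ℓ 0ℓ
m ⊗ G = abelianGroup (ℤ/ m) G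

-- A listing g₁,…,gₙ of the nonzero elements of a (hence finite) abelian
-- group; the group then has order n + 1.

record Listing (A : AbelianGroup 0ℓ 0ℓ) : Set where
  open AbelianGroup A
  field
    n         : ℕ
    g         : Fin n → Carrier
    g-nonzero : ∀ i → ¬ (g i ≈ ε)
    g-inj     : ∀ i j → g i ≈ g j → i ≡ j
    g-surj    : ∀ x → ¬ (x ≈ ε) → ∃ λ i → x ≈ g i

sumℤ : ∀ {k} → (Fin k → ℤ) → ℤ
sumℤ {zero}  f = 0ℤ
sumℤ {suc k} f = f zero + sumℤ (λ i → f (suc i))

‖_‖² : ∀ {k} → (Fin k → ℤ) → ℤ
‖ X ‖² = sumℤ (λ i → X i * X i)

NonZeroVec : ∀ {k} → (Fin k → ℤ) → Set
NonZeroVec X = ∃ λ i → ¬ (X i ≡ 0ℤ)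

-- linear independence (over ℤ, equivalently over ℚ or ℝ) of r integer vectors
LinIndep : ∀ {r k} → (Fin r → Fin k → ℤ) → Set
LinIndep {r} {k} v =
  (c : Fin r → ℤ) → (∀ j → sumℤ (λ i → c i * v i j) ≡ 0ℤ) → ∀ i → c i ≡ 0ℤ

module _ (A : AbelianGroup 0ℓ 0ℓ) where
  open AbelianGroup A

  natmul : ℕ → Carrier → Carrier
  natmul zero    x = ε
  natmul (suc n) x = x ∙ natmul n x

  zmul : ℤ → Carrier → Carrier
  zmul (+ n)    x = natmul n x
  zmul -[1+ n ] x = (natmul (suc n) x) ⁻¹

  gsum : ∀ {k} → (Fin k → Carrier) → Carrier
  gsum {zero}  f = ε
  gsum {suc k} f = f zero ∙ gsum (λ i → f (suc i))

module _ {A : AbelianGroup 0ℓ 0ℓ} (L : Listing A) where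
  open AbelianGroup A
  open Listing L

  InLattice : (Fin (suc n) → ℤ) → Set
  InLattice X =
    (X (fromℕ n) ≡ - sumℤ (λ i → X (inject₁ i)))
    × (gsum A (λ i → zmul A (X (inject₁ i)) (g i)) ≈ ε)

  -- d(G)² = δ : δ is the minimum squared norm of a nonzero lattice vector
  MinNormSq : ℤ → Set
  MinNormSq δ =
    (∃ λ X → InLattice X × NonZeroVec X × ‖ X ‖² ≡ δ)
    × (∀ X → InLattice X → NonZeroVec X → δ Data.Integer.≤ ‖ X ‖²)

  MinDist : ℕ → Set
  MinDist d = MinNormSq (+ d * + d)

  IsMinimalVector : (Fin (suc n) → ℤ) → Set
  IsMinimalVector X = ∃ λ δ → MinNormSq δ × InLattice X × ‖ X ‖² ≡ δ

  WellRounded : Set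
  WellRounded =
    ∃ λ (v : Fin n → Fin (suc n) → ℤ) → (∀ i → IsMinimalVector (v i)) × LinIndep v

module Submission where

-- Every 𝓛(A) has d(A) ≥ 2: a nonzero lattice vector has coordinate sum 0, so
-- its squared norm is even and it has two nonzero coordinates; squared norm 2
-- would force X = ±(e_i - e_j), i.e. a repetition in the list of A.  For
-- H = ℤ_m × G we have |H| = m |G|, and we exhibit |H| - 1 independent lattice
-- vectors of squared norm 4: the minimal vectors of 𝓛(G) moved to 0 × G and,
-- for each residue k ≢ 0 and a fixed g ≠ 0, the vectors
--   U k i = e(k,gᵢ) + e(0,0) - e(k,0) - e(0,gᵢ),   V k = e(k,0) + e(k,g) - e(2k,g) - e(0,0).
-- The moved vectors vanish on the coordinates (k, x) with k ≢ 0, where the U, V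
-- are independent once the doubling system 2 v_s = Σ_{2r ≡ s} v_r has only the
-- zero solution, as it does for m = 2, 3, 4.  Sections: sums and formal
-- combinations; integers; sums in abelian groups; listings and d ≥ 2; the
-- product ℤ_m × G; the construction; the theorem.

open import Defs
open import Level using (0ℓ)
open import Algebra.Bundles using (AbelianGroup)
open import Algebra.Construct.DirectProduct using (abelianGroup)
open import Data.Nat as ℕ using (ℕ; zero; suc; z≤n; s≤s)
import Data.Nat.Properties as ℕP
import Data.Nat.Divisibility as ℕD
open import Data.Integer as ℤ using (ℤ; +_; -[1+_]; _+_; _-_; -_; _*_; 0ℤ; 1ℤ; _≤_; +≤+)
import Data.Integer.Properties as ℤP
open import Algebra.Properties.AbelianGroup ℤP.+-0-abelianGroup using () renaming (inverseʳ-unique to sum≡0⇒≡-)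
open import Data.Integer.DivMod using (_%_; _/_; n%d<d; a≡a%n+[a/n]*n)
open import Data.Integer.Divisibility.Signed using (_∣_; _∣?_; divides; ∣m⇒∣-m; ∣⇒∣ᵤ)
open import Data.Integer.Tactic.RingSolver using (solve-∀)
open import Data.Fin using (Fin; zero; suc; fromℕ; inject₁; toℕ; fromℕ<; _↑ˡ_; _↑ʳ_; splitAt; join; combine; remQuot)
open import Data.Fin.Properties
  using (any?; join-splitAt; remQuot-combine; combine-remQuot; combine-injective; toℕ-injective; toℕ<n;
         toℕ-fromℕ<; injective⇒≤; fromℕ≢inject₁; inject₁-injective)
  renaming (_≟_ to _≟ᶠ_)
open import Data.Vec.Functional using (_++_)
open import Data.Vec.Functional.Properties using (lookup-++ˡ; lookup-++ʳ)
open import Data.Product using (∃; _×_; _,_; proj₁; proj₂; uncurry)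
open import Data.Sum using (_⊎_; inj₁; inj₂)
open import Data.Empty using (⊥; ⊥-elim)
open import Function.Definitions using (Injective)
open import Relation.Binary.PropositionalEquality as ≡ using (_≡_)
open import Relation.Nullary using (¬_; yes; no; Dec)
open import Relation.Nullary.Decidable using (_×-dec_; ¬?; decidable-stable; ¬¬-excluded-middle)

sumℤ-cong : ∀ {k} {f g : Fin k → ℤ} → (∀ i → f i ≡ g i) → sumℤ f ≡ sumℤ g
sumℤ-cong {zero}  f≗g = ≡.refl
sumℤ-cong {suc k} f≗g = ≡.cong₂ _+_ (f≗g zero) (sumℤ-cong (λ i → f≗g (suc i)))

sumℤ-zero : ∀ {k} {f : Fin k → ℤ} → (∀ i → f i ≡ 0ℤ) → sumℤ f ≡ 0ℤ
sumℤ-zero {zero}  f≗0 = ≡.refl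
sumℤ-zero {suc k} f≗0 = ≡.cong₂ _+_ (f≗0 zero) (sumℤ-zero (λ i → f≗0 (suc i)))

sumℤ-+ : ∀ {k} (f g : Fin k → ℤ) → sumℤ (λ i → f i + g i) ≡ sumℤ f + sumℤ g
sumℤ-+ {zero}  f g = ≡.refl
sumℤ-+ {suc k} f g =
  ≡.trans (≡.cong (_+_ (f zero + g zero)) (sumℤ-+ (λ i → f (suc i)) (λ i → g (suc i))))
          (interchange (f zero) (g zero) _ _)
  where
  interchange : ∀ a b c d → a + b + (c + d) ≡ a + c + (b + d)
  interchange = solve-∀

sumℤ-*ˡ : ∀ {k} (c : ℤ) (f : Fin k → ℤ) → sumℤ (λ i → c * f i) ≡ c * sumℤ f
sumℤ-*ˡ {zero}  c f = ≡.sym (ℤP.*-zeroʳ c)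
sumℤ-*ˡ {suc k} c f =
  ≡.trans (≡.cong (_+_ (c * f zero)) (sumℤ-*ˡ c (λ i → f (suc i)))) (≡.sym (ℤP.*-distribˡ-+ c (f zero) _))

sumℤ-swap : ∀ {k l} (f : Fin k → Fin l → ℤ) →
  sumℤ (λ i → sumℤ (λ j → f i j)) ≡ sumℤ (λ j → sumℤ (λ i → f i j))
sumℤ-swap {zero} {l} f = ≡.sym (sumℤ-zero {l} (λ _ → ≡.refl))
sumℤ-swap {suc k} f =
  ≡.trans (≡.cong (_+_ (sumℤ (f zero))) (sumℤ-swap (λ i → f (suc i)))) (≡.sym (sumℤ-+ (f zero) _))

sumℤ-init-last : ∀ {k} (f : Fin (suc k) → ℤ) → sumℤ f ≡ sumℤ (λ i → f (inject₁ i)) + f (fromℕ k)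
sumℤ-init-last {zero}  f = ℤP.+-comm (f zero) 0ℤ
sumℤ-init-last {suc k} f =
  ≡.trans (≡.cong (_+_ (f zero)) (sumℤ-init-last (λ i → f (suc i)))) (≡.sym (ℤP.+-assoc (f zero) _ _))

sumℤ-join : ∀ a {b} (f : Fin (a ℕ.+ b) → ℤ) → sumℤ f ≡ sumℤ (λ i → f (i ↑ˡ b)) + sumℤ (λ i → f (a ↑ʳ i))
sumℤ-join zero    f = ≡.sym (ℤP.+-identityˡ _)
sumℤ-join (suc a) f =
  ≡.trans (≡.cong (_+_ (f zero)) (sumℤ-join a (λ i → f (suc i)))) (≡.sym (ℤP.+-assoc (f zero) _ _))

sumℤ-combine : ∀ a b (f : Fin (a ℕ.* b) → ℤ) → sumℤ f ≡ sumℤ {a} (λ r → sumℤ {b} (λ x → f (combine r x)))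
sumℤ-combine zero    b f = ≡.refl
sumℤ-combine (suc a) b f =
  ≡.trans (sumℤ-join b f) (≡.cong (_+_ (sumℤ (λ x → f (x ↑ˡ (a ℕ.* b))))) (sumℤ-combine a b (λ u → f (b ↑ʳ u))))

δ : ∀ {k} → Fin k → Fin k → ℤ
δ zero    zero    = 1ℤ
δ zero    (suc j) = 0ℤ
δ (suc i) zero    = 0ℤ
δ (suc i) (suc j) = δ i j

δ-diag : ∀ {k} (i : Fin k) → δ i i ≡ 1ℤ
δ-diag zero    = ≡.refl
δ-diag (suc i) = δ-diag i

δ-off : ∀ {k} {i j : Fin k} → ¬ i ≡ j → δ i j ≡ 0ℤ
δ-off {i = zero}  {zero}  i≢j = ⊥-elim (i≢j ≡.refl)
δ-off {i = zero}  {suc j} i≢j = ≡.refl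
δ-off {i = suc i} {zero}  i≢j = ≡.refl
δ-off {i = suc i} {suc j} i≢j = δ-off (λ i≡j → i≢j (≡.cong suc i≡j))

δ-sym : ∀ {k} (i j : Fin k) → δ i j ≡ δ j i
δ-sym zero    zero    = ≡.refl
δ-sym zero    (suc j) = ≡.refl
δ-sym (suc i) zero    = ≡.refl
δ-sym (suc i) (suc j) = δ-sym i j

δ-injective : ∀ {k l} (p : Fin k → Fin l) → Injective _≡_ _≡_ p → ∀ s t → δ (p s) (p t) ≡ δ s t
δ-injective p p-inj s t with s ≟ᶠ t
... | yes ≡.refl = ≡.trans (δ-diag (p s)) (≡.sym (δ-diag s))
... | no s≢t     = ≡.trans (δ-off (λ e → s≢t (p-inj e))) (≡.sym (δ-off s≢t))

sum-δ : ∀ {k} (f : Fin k → ℤ) (j : Fin k) → sumℤ (λ i → f i * δ i j) ≡ f j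
sum-δ {suc k} f zero =
  ≡.trans (≡.cong₂ _+_ (ℤP.*-identityʳ (f zero)) (sumℤ-zero (λ i → ℤP.*-zeroʳ (f (suc i)))))
          (ℤP.+-identityʳ (f zero))
sum-δ {suc k} f (suc j) =
  ≡.trans (≡.cong (_+ sumℤ (λ i → f (suc i) * δ i j)) (ℤP.*-zeroʳ (f zero)))
          (≡.trans (ℤP.+-identityˡ _) (sum-δ (λ i → f (suc i)) j))

sum-δ′ : ∀ {k} (f : Fin k → ℤ) (j : Fin k) → sumℤ (λ i → f i * δ j i) ≡ f j
sum-δ′ f j = ≡.trans (sumℤ-cong (λ i → ≡.cong (f i *_) (δ-sym j i))) (sum-δ f j)

-- Formal integer combinations: combo c p is the vector Σ_t c_t e_{p t} of ℤᵏ.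

combo : ∀ {r k} → (Fin r → ℤ) → (Fin r → Fin k) → Fin k → ℤ
combo c p j = sumℤ (λ t → c t * δ (p t) j)

combo-sum : ∀ {r k} (c : Fin r → ℤ) (p : Fin r → Fin k) → sumℤ (combo c p) ≡ sumℤ c
combo-sum c p = begin
  sumℤ (combo c p)                              ≡⟨ sumℤ-swap (λ j t → c t * δ (p t) j) ⟩
  sumℤ (λ t → sumℤ (λ j → c t * δ (p t) j))     ≡⟨ sumℤ-cong (λ t → sumℤ-*ˡ (c t) (δ (p t))) ⟩
  sumℤ (λ t → c t * sumℤ (δ (p t)))             ≡⟨ sumℤ-cong (λ t → ≡.cong (c t *_) (sum-row (p t))) ⟩
  sumℤ (λ t → c t * 1ℤ)                         ≡⟨ sumℤ-cong (λ t → ℤP.*-identityʳ (c t)) ⟩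
  sumℤ c                                        ∎
  where
  open ≡.≡-Reasoning
  sum-row : ∀ {k} (i : Fin k) → sumℤ (δ i) ≡ 1ℤ
  sum-row i = ≡.trans (sumℤ-cong (λ j → ≡.sym (ℤP.*-identityˡ (δ i j)))) (sum-δ′ (λ _ → 1ℤ) i)

combo-at : ∀ {r k} (c : Fin r → ℤ) (p : Fin r → Fin k) → Injective _≡_ _≡_ p → ∀ t → combo c p (p t) ≡ c t
combo-at c p p-inj t =
  ≡.trans (sumℤ-cong (λ s → ≡.cong (c s *_) (δ-injective p p-inj s t))) (sum-δ c t)

combo-outside : ∀ {r k} (c : Fin r → ℤ) (p : Fin r → Fin k) j → (∀ t → ¬ p t ≡ j) → combo c p j ≡ 0ℤ
combo-outside c p j j∉p =
  sumℤ-zero (λ t → ≡.trans (≡.cong (c t *_) (δ-off (j∉p t))) (ℤP.*-zeroʳ (c t)))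

norm-combo : ∀ {r k} (c : Fin r → ℤ) (p : Fin r → Fin k) → Injective _≡_ _≡_ p →
  ‖ combo c p ‖² ≡ sumℤ (λ t → c t * c t)
norm-combo c p p-inj = begin
  sumℤ (λ j → combo c p j * sumℤ (λ t → c t * δ (p t) j))
    ≡⟨ sumℤ-cong (λ j → ≡.sym (sumℤ-*ˡ (combo c p j) (λ t → c t * δ (p t) j))) ⟩
  sumℤ (λ j → sumℤ (λ t → combo c p j * (c t * δ (p t) j)))
    ≡⟨ sumℤ-swap (λ j t → combo c p j * (c t * δ (p t) j)) ⟩
  sumℤ (λ t → sumℤ (λ j → combo c p j * (c t * δ (p t) j)))
    ≡⟨ sumℤ-cong (λ t → sumℤ-cong (λ j → rearrange (combo c p j) (c t) (δ (p t) j))) ⟩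
  sumℤ (λ t → sumℤ (λ j → c t * (combo c p j * δ (p t) j)))
    ≡⟨ sumℤ-cong (λ t → sumℤ-*ˡ (c t) (λ j → combo c p j * δ (p t) j)) ⟩
  sumℤ (λ t → c t * sumℤ (λ j → combo c p j * δ (p t) j))
    ≡⟨ sumℤ-cong (λ t → ≡.cong (c t *_) (≡.trans (sum-δ′ (combo c p) (p t)) (combo-at c p p-inj t))) ⟩
  sumℤ (λ t → c t * c t) ∎
  where
  open ≡.≡-Reasoning
  rearrange : ∀ a b d → a * (b * d) ≡ b * (a * d)
  rearrange = solve-∀

IndepOn : ∀ {r k} → (Fin k → Set) → (Fin r → Fin k → ℤ) → Set
IndepOn {r} P g = (c : Fin r → ℤ) → (∀ j → P j → sumℤ (λ t → c t * g t j) ≡ 0ℤ) → ∀ t → c t ≡ 0ℤ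

IndepOn₂ : ∀ {a b k} → (Fin k → Set) → (Fin a → Fin b → Fin k → ℤ) → Set
IndepOn₂ {a} {b} P B = (c : Fin a → Fin b → ℤ) →
  (∀ j → P j → sumℤ (λ r → sumℤ (λ x → c r x * B r x j)) ≡ 0ℤ) → ∀ r x → c r x ≡ 0ℤ

uncurry-indep : ∀ {a b k} {P : Fin k → Set} (B : Fin a → Fin b → Fin k → ℤ) →
  IndepOn₂ P B → IndepOn P (λ t → uncurry B (remQuot b t))
uncurry-indep {a} {b} {P = P} B B-indep c rel t =
  ≡.subst (λ s → c s ≡ 0ℤ) (combine-remQuot {a} b t) (c₂-zero (remQuot b t))
  where
  c₂ : Fin a → Fin b → ℤ
  c₂ r x = c (combine r x)
  rel₂ : ∀ j → P j → sumℤ (λ r → sumℤ (λ x → c₂ r x * B r x j)) ≡ 0ℤ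
  rel₂ j Pj = begin
    sumℤ (λ r → sumℤ (λ x → c₂ r x * B r x j))
      ≡⟨ sumℤ-cong (λ r → sumℤ-cong (λ x → ≡.cong (λ q → c₂ r x * uncurry B q j) (remQuot-combine r x))) ⟨
    sumℤ {a} (λ r → sumℤ {b} (λ x → c (combine r x) * uncurry B (remQuot b (combine r x)) j))
      ≡⟨ sumℤ-combine a b (λ t → c t * uncurry B (remQuot b t) j) ⟨
    sumℤ (λ t → c t * uncurry B (remQuot b t) j)
      ≡⟨ rel j Pj ⟩
    0ℤ ∎
    where open ≡.≡-Reasoning
  c₂-zero : ∀ q → c (uncurry combine q) ≡ 0ℤ
  c₂-zero (r , x) = B-indep c₂ rel₂ r x

-- Block triangularity: if f is independent and vanishes on the coordinates P,
-- and g is independent on P, then the concatenated family f ++ g is independent.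
append-indep : ∀ {a b k} {P : Fin k → Set} (f : Fin a → Fin k → ℤ) (g : Fin b → Fin k → ℤ) →
  LinIndep f → (∀ s j → P j → f s j ≡ 0ℤ) → IndepOn P g → LinIndep (f ++ g)
append-indep {a} {b} {k} f g f-indep f-vanish g-indep c rel t =
  ≡.subst (λ s → c s ≡ 0ℤ) (join-splitAt a b t) (c-zero (splitAt a t))
  where
  open ≡.≡-Reasoning
  cf : Fin a → ℤ
  cf s = c (s ↑ˡ b)
  cg : Fin b → ℤ
  cg s = c (a ↑ʳ s)
  f-part g-part : Fin k → ℤ
  f-part j = sumℤ (λ s → cf s * f s j)
  g-part j = sumℤ (λ s → cg s * g s j)
  split : ∀ j → f-part j + g-part j ≡ 0ℤ
  split j = begin
    f-part j + g-part j
      ≡⟨ ≡.cong₂ _+_ (sumℤ-cong (λ s → ≡.cong (λ v → cf s * v j) (lookup-++ˡ f g s)))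
                     (sumℤ-cong (λ s → ≡.cong (λ v → cg s * v j) (lookup-++ʳ f g s))) ⟨
    sumℤ (λ s → c (s ↑ˡ b) * (f ++ g) (s ↑ˡ b) j) + sumℤ (λ s → c (a ↑ʳ s) * (f ++ g) (a ↑ʳ s) j)
      ≡⟨ sumℤ-join a (λ t → c t * (f ++ g) t j) ⟨
    sumℤ (λ t → c t * (f ++ g) t j)
      ≡⟨ rel j ⟩
    0ℤ ∎
  cg-zero : ∀ s → cg s ≡ 0ℤ
  cg-zero = g-indep cg (λ j Pj → begin
    g-part j            ≡⟨ ℤP.+-identityˡ (g-part j) ⟨
    0ℤ + g-part j       ≡⟨ ≡.cong (_+ g-part j) (sumℤ-zero (λ s → ≡.trans (≡.cong (cf s *_) (f-vanish s j Pj)) (ℤP.*-zeroʳ (cf s)))) ⟨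
    f-part j + g-part j ≡⟨ split j ⟩
    0ℤ                  ∎)
  cf-zero : ∀ s → cf s ≡ 0ℤ
  cf-zero = f-indep cf (λ j → begin
    f-part j            ≡⟨ ℤP.+-identityʳ (f-part j) ⟨
    f-part j + 0ℤ       ≡⟨ ≡.cong (_+_ (f-part j)) (sumℤ-zero (λ s → ≡.cong (_* g s j) (cg-zero s))) ⟨
    f-part j + g-part j ≡⟨ split j ⟩
    0ℤ                  ∎)
  c-zero : ∀ q → c (join a b q) ≡ 0ℤ
  c-zero (inj₁ s) = cf-zero s
  c-zero (inj₂ s) = cg-zero s

++-all : ∀ {ℓ} {S : Set} {a b} (P : S → Set ℓ) (f : Fin a → S) (g : Fin b → S) →
  (∀ s → P (f s)) → (∀ s → P (g s)) → ∀ t → P ((f ++ g) t)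
++-all {a = a} P f g Pf Pg t with splitAt a t
... | inj₁ s = Pf s
... | inj₂ s = Pg s

embed-indep : ∀ {r k l} (w : Fin r → Fin k → ℤ) (p : Fin k → Fin l) → Injective _≡_ _≡_ p →
  LinIndep w → LinIndep (λ s → combo (w s) p)
embed-indep w p p-inj w-indep c rel =
  w-indep c (λ y → ≡.trans (sumℤ-cong (λ s → ≡.cong (c s *_) (≡.sym (combo-at (w s) p p-inj y)))) (rel (p y)))

support-combo : ∀ {r k} (X : Fin k → ℤ) (p : Fin r → Fin k) → Injective _≡_ _≡_ p →
  (∀ l → (∀ t → ¬ p t ≡ l) → X l ≡ 0ℤ) → ∀ l → X l ≡ combo (λ t → X (p t)) p l
support-combo X p p-inj off l with any? (λ t → p t ≟ᶠ l)
... | yes (t , ≡.refl) = ≡.sym (combo-at (λ s → X (p s)) p p-inj t)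
... | no  l∉p          = ≡.trans (off l (λ t e → l∉p (t , e)))
                                 (≡.sym (combo-outside (λ s → X (p s)) p l (λ t e → l∉p (t , e))))

single : ∀ {k} → Fin k → Fin 1 → Fin k
single i _ = i

single-injective : ∀ {k} (i : Fin k) → Injective _≡_ _≡_ (single i)
single-injective i {zero} {zero} _ = ≡.refl

pair : ∀ {k} → Fin k → Fin k → Fin 2 → Fin k
pair i j zero       = i
pair i j (suc zero) = j

pair-injective : ∀ {k} {i j : Fin k} → ¬ i ≡ j → Injective _≡_ _≡_ (pair i j)
pair-injective i≢j {zero}     {zero}     _ = ≡.refl
pair-injective i≢j {zero}     {suc zero} e = ⊥-elim (i≢j e)
pair-injective i≢j {suc zero} {zero}     e = ⊥-elim (i≢j (≡.sym e))
pair-injective i≢j {suc zero} {suc zero} _ = ≡.refl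

nonzero⇒positive-rank : ∀ {k} (X : Fin (suc k) → ℤ) → X (fromℕ k) ≡ - sumℤ (λ i → X (inject₁ i)) →
  NonZeroVec X → Fin k
nonzero⇒positive-rank {zero}  X last≡ (zero , X₀≢0) = ⊥-elim (X₀≢0 last≡)
nonzero⇒positive-rank {suc k} X last≡ _              = zero

corners : ∀ {ℓ} {S : Set ℓ} → S → S → S → S → Fin 4 → S
corners a b c d zero                   = a
corners a b c d (suc zero)             = b
corners a b c d (suc (suc zero))       = c
corners a b c d (suc (suc (suc zero))) = d

signs : Fin 4 → ℤ
signs = corners 1ℤ 1ℤ (- 1ℤ) (- 1ℤ)

quad : ∀ {k} → Fin k → Fin k → Fin k → Fin k → Fin k → ℤ
quad a b c d = combo signs (corners a b c d)

quad-at : ∀ {k} (a b c d j : Fin k) → quad a b c d j ≡ δ a j + δ b j - δ c j - δ d j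
quad-at a b c d j = expand (δ a j) (δ b j) (δ c j) (δ d j)
  where
  expand : ∀ x y z w → 1ℤ * x + (1ℤ * y + (- 1ℤ * z + (- 1ℤ * w + 0ℤ))) ≡ x + y - z - w
  expand = solve-∀

record Distinct4 {k} (a b c d : Fin k) : Set where
  field
    a≢b : ¬ a ≡ b
    a≢c : ¬ a ≡ c
    a≢d : ¬ a ≡ d
    b≢c : ¬ b ≡ c
    b≢d : ¬ b ≡ d
    c≢d : ¬ c ≡ d

corners-injective : ∀ {k} {a b c d : Fin k} → Distinct4 a b c d → Injective _≡_ _≡_ (corners a b c d)
corners-injective D {zero}                   {zero}                   _ = ≡.refl
corners-injective D {zero}                   {suc zero}               e = ⊥-elim (Distinct4.a≢b D e)
corners-injective D {zero}                   {suc (suc zero)}         e = ⊥-elim (Distinct4.a≢c D e)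
corners-injective D {zero}                   {suc (suc (suc zero))}   e = ⊥-elim (Distinct4.a≢d D e)
corners-injective D {suc zero}               {zero}                   e = ⊥-elim (Distinct4.a≢b D (≡.sym e))
corners-injective D {suc zero}               {suc zero}               _ = ≡.refl
corners-injective D {suc zero}               {suc (suc zero)}         e = ⊥-elim (Distinct4.b≢c D e)
corners-injective D {suc zero}               {suc (suc (suc zero))}   e = ⊥-elim (Distinct4.b≢d D e)
corners-injective D {suc (suc zero)}         {zero}                   e = ⊥-elim (Distinct4.a≢c D (≡.sym e))
corners-injective D {suc (suc zero)}         {suc zero}               e = ⊥-elim (Distinct4.b≢c D (≡.sym e))
corners-injective D {suc (suc zero)}         {suc (suc zero)}         _ = ≡.refl
corners-injective D {suc (suc zero)}         {suc (suc (suc zero))}   e = ⊥-elim (Distinct4.c≢d D e)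
corners-injective D {suc (suc (suc zero))}   {zero}                   e = ⊥-elim (Distinct4.a≢d D (≡.sym e))
corners-injective D {suc (suc (suc zero))}   {suc zero}               e = ⊥-elim (Distinct4.b≢d D (≡.sym e))
corners-injective D {suc (suc (suc zero))}   {suc (suc zero)}         e = ⊥-elim (Distinct4.c≢d D (≡.sym e))
corners-injective D {suc (suc (suc zero))}   {suc (suc (suc zero))}   _ = ≡.refl

norm-quad : ∀ {k} {a b c d : Fin k} → Distinct4 a b c d → ‖ quad a b c d ‖² ≡ + 4
norm-quad D = norm-combo signs (corners _ _ _ _) (corners-injective D)

square-nonneg : ∀ x → 0ℤ ≤ x * x
square-nonneg (+ n)    = ≡.subst (0ℤ ≤_) (ℤP.pos-* n n) (+≤+ z≤n)
square-nonneg -[1+ n ] = +≤+ z≤n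

Unit : ℤ → Set
Unit x = x ≡ 1ℤ ⊎ x ≡ - 1ℤ

unit-or-big : ∀ x → ¬ x ≡ 0ℤ → Unit x ⊎ + 4 ≤ x * x
unit-or-big (+ zero)        x≢0 = ⊥-elim (x≢0 ≡.refl)
unit-or-big (+ suc zero)    _   = inj₁ (inj₁ ≡.refl)
unit-or-big (+ suc (suc k)) _   = inj₂ (≡.subst (+ 4 ≤_) (ℤP.pos-* (suc (suc k)) (suc (suc k))) (+≤+ (four≤ k)))
  where
  four≤ : ∀ k → 4 ℕ.≤ suc (suc k) ℕ.* suc (suc k)
  four≤ k = ℕP.*-mono-≤ {2} {suc (suc k)} {2} (s≤s (s≤s z≤n)) (s≤s (s≤s z≤n))
unit-or-big -[1+ zero ]     _   = inj₁ (inj₂ ≡.refl)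
unit-or-big -[1+ suc k ]    _   = inj₂ (+≤+ (ℕP.*-mono-≤ {2} {suc (suc k)} {2} (s≤s (s≤s z≤n)) (s≤s (s≤s z≤n))))

unit-square : ∀ {x} → Unit x → x * x ≡ 1ℤ
unit-square (inj₁ ≡.refl) = ≡.refl
unit-square (inj₂ ≡.refl) = ≡.refl

-- x² ≡ x (mod 2), hence a vector with coordinate sum 0 has even squared norm.
square-parity : ∀ x → ∃ λ h → x * x ≡ x + + 2 * h
square-parity x =
  ≡.subst (λ y → ∃ λ h → y * y ≡ y + + 2 * h) (≡.sym (a≡a%n+[a/n]*n x (+ 2))) (by-residue (x % + 2) (x / + 2) (n%d<d x (+ 2)))
  where
  by-residue : ∀ r q → r ℕ.< 2 → ∃ λ h → (+ r + q * + 2) * (+ r + q * + 2) ≡ (+ r + q * + 2) + + 2 * h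
  by-residue zero          q _ = q * q * + 2 - q , even q
    where
    even : ∀ q → (+ 0 + q * + 2) * (+ 0 + q * + 2) ≡ (+ 0 + q * + 2) + + 2 * (q * q * + 2 - q)
    even = solve-∀
  by-residue (suc zero)    q _ = q + q * q * + 2 , odd q
    where
    odd : ∀ q → (+ 1 + q * + 2) * (+ 1 + q * + 2) ≡ (+ 1 + q * + 2) + + 2 * (q + q * q * + 2)
    odd = solve-∀
  by-residue (suc (suc r)) q (s≤s (s≤s ()))

norm-even : ∀ {k} (X : Fin k → ℤ) → sumℤ X ≡ 0ℤ → + 2 ∣ ‖ X ‖²
norm-even {k} X sum≡0 = divides (sumℤ half) (≡.trans norm≡ (ℤP.*-comm (+ 2) _))
  where
  half : Fin k → ℤ
  half i = proj₁ (square-parity (X i))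
  norm≡ : ‖ X ‖² ≡ + 2 * sumℤ half
  norm≡ = begin
    ‖ X ‖²                                ≡⟨ sumℤ-cong (λ i → proj₂ (square-parity (X i))) ⟩
    sumℤ (λ i → X i + + 2 * half i)       ≡⟨ sumℤ-+ X (λ i → + 2 * half i) ⟩
    sumℤ X + sumℤ (λ i → + 2 * half i)    ≡⟨ ≡.cong₂ _+_ sum≡0 (sumℤ-*ˡ (+ 2) half) ⟩
    0ℤ + + 2 * sumℤ half                  ≡⟨ ℤP.+-identityˡ _ ⟩
    + 2 * sumℤ half                       ∎
    where open ≡.≡-Reasoning

even-≥3⇒≥4 : ∀ {S} → + 2 ∣ S → + 3 ≤ S → + 4 ≤ S
even-≥3⇒≥4 {+ s} 2∣S (+≤+ 3≤s) with s ℕP.≟ 3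
... | yes ≡.refl = ⊥-elim (two∤three 2∣S)
  where
  two∤three : ¬ (+ 2 ∣ + 3)
  two∤three (divides (+ zero) ())
  two∤three (divides (+ suc zero) ())
  two∤three (divides (+ suc (suc q)) ())
  two∤three (divides -[1+ q ] ())
... | no s≢3   = +≤+ (ℕP.≤∧≢⇒< 3≤s (λ 3≡s → s≢3 (≡.sym 3≡s)))

sumℤ-mono : ∀ {k} {f g : Fin k → ℤ} → (∀ i → f i ≤ g i) → sumℤ f ≤ sumℤ g
sumℤ-mono {zero}  f≤g = ℤP.≤-refl
sumℤ-mono {suc k} f≤g = ℤP.+-mono-≤ (f≤g zero) (sumℤ-mono (λ i → f≤g (suc i)))

weighted-≤ : ∀ {k} (f e : Fin k → ℤ) → (∀ i → 0ℤ ≤ f i) → (∀ i → e i ≡ 0ℤ ⊎ e i ≡ 1ℤ) →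
  sumℤ (λ i → f i * e i) ≤ sumℤ f
weighted-≤ f e f≥0 e∈01 = sumℤ-mono (λ i → drop (f i) (f≥0 i) (e∈01 i))
  where
  drop : ∀ a {b} → 0ℤ ≤ a → b ≡ 0ℤ ⊎ b ≡ 1ℤ → a * b ≤ a
  drop a a≥0 (inj₁ ≡.refl) = ≡.subst (_≤ a) (≡.sym (ℤP.*-zeroʳ a)) a≥0
  drop a a≥0 (inj₂ ≡.refl) = ℤP.≤-reflexive (ℤP.*-identityʳ a)

term-≤-sum : ∀ {k} (f : Fin k → ℤ) → (∀ i → 0ℤ ≤ f i) → ∀ l → f l ≤ sumℤ f
term-≤-sum f f≥0 l = ≡.subst (_≤ sumℤ f) (sum-δ′ f l) (weighted-≤ f (δ l) f≥0 δ∈01)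
  where
  δ∈01 : ∀ t → δ l t ≡ 0ℤ ⊎ δ l t ≡ 1ℤ
  δ∈01 t with l ≟ᶠ t
  ... | yes ≡.refl = inj₂ (δ-diag l)
  ... | no l≢t     = inj₁ (δ-off l≢t)

three-terms-≤-sum : ∀ {k} (f : Fin k → ℤ) → (∀ i → 0ℤ ≤ f i) → ∀ i j l →
  ¬ i ≡ j → ¬ i ≡ l → ¬ j ≡ l → f i + f j + f l ≤ sumℤ f
three-terms-≤-sum {k} f f≥0 i j l i≢j i≢l j≢l =
  ≡.subst (_≤ sumℤ f) picks (weighted-≤ f e f≥0 e∈01)
  where
  e : Fin k → ℤ
  e t = δ i t + δ j t + δ l t
  picks : sumℤ (λ t → f t * e t) ≡ f i + f j + f l
  picks = begin
    sumℤ (λ t → f t * e t)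
      ≡⟨ sumℤ-cong (λ t → distrib (f t) (δ i t) (δ j t) (δ l t)) ⟩
    sumℤ (λ t → (f t * δ i t + f t * δ j t) + f t * δ l t)
      ≡⟨ sumℤ-+ (λ t → f t * δ i t + f t * δ j t) (λ t → f t * δ l t) ⟩
    sumℤ (λ t → f t * δ i t + f t * δ j t) + sumℤ (λ t → f t * δ l t)
      ≡⟨ ≡.cong (_+ sumℤ (λ t → f t * δ l t)) (sumℤ-+ (λ t → f t * δ i t) (λ t → f t * δ j t)) ⟩
    sumℤ (λ t → f t * δ i t) + sumℤ (λ t → f t * δ j t) + sumℤ (λ t → f t * δ l t)
      ≡⟨ ≡.cong₂ _+_ (≡.cong₂ _+_ (sum-δ′ f i) (sum-δ′ f j)) (sum-δ′ f l) ⟩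
    f i + f j + f l ∎
    where
    open ≡.≡-Reasoning
    distrib : ∀ a x y z → a * (x + y + z) ≡ (a * x + a * y) + a * z
    distrib = solve-∀
  e∈01 : ∀ t → e t ≡ 0ℤ ⊎ e t ≡ 1ℤ
  e∈01 t with i ≟ᶠ t | j ≟ᶠ t | l ≟ᶠ t
  ... | yes ≡.refl | yes ≡.refl | _          = ⊥-elim (i≢j ≡.refl)
  ... | yes ≡.refl | no _       | yes ≡.refl = ⊥-elim (i≢l ≡.refl)
  ... | no _       | yes ≡.refl | yes ≡.refl = ⊥-elim (j≢l ≡.refl)
  ... | yes ≡.refl | no b       | no c       = inj₂ (≡.cong₂ _+_ (≡.cong₂ _+_ (δ-diag i) (δ-off b)) (δ-off c))
  ... | no a       | yes ≡.refl | no c       = inj₂ (≡.cong₂ _+_ (≡.cong₂ _+_ (δ-off a) (δ-diag j)) (δ-off c))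
  ... | no a       | no b       | yes ≡.refl = inj₂ (≡.cong₂ _+_ (≡.cong₂ _+_ (δ-off a) (δ-off b)) (δ-diag l))
  ... | no a       | no b       | no c       = inj₁ (≡.cong₂ _+_ (≡.cong₂ _+_ (δ-off a) (δ-off b)) (δ-off c))

-- The key fact is
-- 'Σ-combo': evaluating a formal combination Σ_t c_t e_{p t} against a
-- family h gives Σ_t c_t · h (p t); it rests on z ↦ z · x being additive.

module GroupSums (A : AbelianGroup 0ℓ 0ℓ) where
  open AbelianGroup A
  open import Algebra.Properties.AbelianGroup A using (⁻¹-∙-comm)
  open import Algebra.Properties.Group group using (ε⁻¹≈ε; ⁻¹-involutive; x∙y⁻¹≈ε⇒x≈y)
  open import Algebra.Properties.CommutativeSemigroup commutativeSemigroup using (interchange)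
  open import Relation.Binary.Reasoning.Setoid setoid

  infixr 8 _·_
  _·_ : ℤ → Carrier → Carrier
  _·_ = zmul A

  Σ : ∀ {k} → (Fin k → Carrier) → Carrier
  Σ = gsum A

  ·-congʳ : ∀ z {x y} → x ≈ y → z · x ≈ z · y
  ·-congʳ (+ a)    x≈y = natmul-cong a x≈y
    where
    natmul-cong : ∀ a {x y} → x ≈ y → natmul A a x ≈ natmul A a y
    natmul-cong zero    x≈y = refl
    natmul-cong (suc a) x≈y = ∙-cong x≈y (natmul-cong a x≈y)
  ·-congʳ -[1+ a ] x≈y = ⁻¹-cong (·-congʳ (+ suc a) x≈y)

  ·-congˡ : ∀ {z w} x → z ≡ w → z · x ≈ w · x
  ·-congˡ x ≡.refl = refl

  ·-ε : ∀ z → z · ε ≈ ε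
  ·-ε (+ a)    = natmul-ε a
    where
    natmul-ε : ∀ a → natmul A a ε ≈ ε
    natmul-ε zero    = refl
    natmul-ε (suc a) = trans (identityˡ _) (natmul-ε a)
  ·-ε -[1+ a ] = trans (⁻¹-cong (·-ε (+ suc a))) ε⁻¹≈ε

  1· : ∀ x → 1ℤ · x ≈ x
  1· x = identityʳ x

  -1· : ∀ x → (- 1ℤ) · x ≈ x ⁻¹
  -1· x = ⁻¹-cong (identityʳ x)

  private
    cancel : ∀ x w → x ∙ (x ⁻¹ ∙ w) ≈ w
    cancel x w = begin
      x ∙ (x ⁻¹ ∙ w) ≈⟨ sym (assoc _ _ _) ⟩
      (x ∙ x ⁻¹) ∙ w ≈⟨ ∙-congʳ (inverseʳ x) ⟩
      ε ∙ w          ≈⟨ identityˡ w ⟩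
      w              ∎

    suc-· : ∀ z x → (1ℤ + z) · x ≈ x ∙ z · x
    suc-· (+ a)          x = refl
    suc-· -[1+ zero ]    x = sym (trans (∙-congˡ (-1· x)) (inverseʳ x))
    suc-· -[1+ suc a ]   x = sym (begin
      x ∙ (x ∙ (x ∙ natmul A a x)) ⁻¹     ≈⟨ ∙-congˡ (sym (⁻¹-∙-comm x _)) ⟩
      x ∙ (x ⁻¹ ∙ (x ∙ natmul A a x) ⁻¹)  ≈⟨ cancel x _ ⟩
      (x ∙ natmul A a x) ⁻¹              ∎)

    pred-· : ∀ z x → (- 1ℤ + z) · x ≈ x ⁻¹ ∙ z · x
    pred-· z x = begin
      (- 1ℤ + z) · x                          ≈⟨ sym (cancel (x ⁻¹) _) ⟩
      x ⁻¹ ∙ ((x ⁻¹) ⁻¹ ∙ (- 1ℤ + z) · x)     ≈⟨ ∙-congˡ (∙-congʳ (⁻¹-involutive x)) ⟩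
      x ⁻¹ ∙ (x ∙ (- 1ℤ + z) · x)             ≈⟨ ∙-congˡ (sym (suc-· (- 1ℤ + z) x)) ⟩
      x ⁻¹ ∙ (1ℤ + (- 1ℤ + z)) · x            ≈⟨ ∙-congˡ (·-congˡ x (≡.trans (≡.sym (ℤP.+-assoc 1ℤ (- 1ℤ) z)) (ℤP.+-identityˡ z))) ⟩
      x ⁻¹ ∙ z · x                            ∎

  +-· : ∀ z w x → (z + w) · x ≈ z · x ∙ w · x
  +-· (+ zero)        w x = trans (·-congˡ x (ℤP.+-identityˡ w)) (sym (identityˡ _))
  +-· (+ suc a)       w x = begin
    (+ suc a + w) · x           ≈⟨ ·-congˡ x (ℤP.+-assoc 1ℤ (+ a) w) ⟩
    (1ℤ + (+ a + w)) · x        ≈⟨ suc-· (+ a + w) x ⟩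
    x ∙ (+ a + w) · x           ≈⟨ ∙-congˡ (+-· (+ a) w x) ⟩
    x ∙ ((+ a) · x ∙ w · x)     ≈⟨ sym (assoc _ _ _) ⟩
    (+ suc a) · x ∙ w · x       ∎
  +-· -[1+ zero ]     w x = trans (pred-· w x) (∙-congʳ (sym (-1· x)))
  +-· -[1+ suc a ]    w x = begin
    (-[1+ suc a ] + w) · x                ≈⟨ ·-congˡ x (ℤP.+-assoc (- 1ℤ) -[1+ a ] w) ⟩
    (- 1ℤ + (-[1+ a ] + w)) · x           ≈⟨ pred-· (-[1+ a ] + w) x ⟩
    x ⁻¹ ∙ (-[1+ a ] + w) · x             ≈⟨ ∙-congˡ (+-· -[1+ a ] w x) ⟩
    x ⁻¹ ∙ (-[1+ a ] · x ∙ w · x)         ≈⟨ sym (assoc _ _ _) ⟩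
    (x ⁻¹ ∙ -[1+ a ] · x) ∙ w · x         ≈⟨ ∙-congʳ (⁻¹-∙-comm x _) ⟩
    -[1+ suc a ] · x ∙ w · x              ∎

  Σ-cong : ∀ {k} {f g : Fin k → Carrier} → (∀ i → f i ≈ g i) → Σ f ≈ Σ g
  Σ-cong {zero}  f≈g = refl
  Σ-cong {suc k} f≈g = ∙-cong (f≈g zero) (Σ-cong (λ i → f≈g (suc i)))

  Σ-ε : ∀ {k} {f : Fin k → Carrier} → (∀ i → f i ≈ ε) → Σ f ≈ ε
  Σ-ε {zero}  f≈ε = refl
  Σ-ε {suc k} f≈ε = trans (∙-cong (f≈ε zero) (Σ-ε (λ i → f≈ε (suc i)))) (identityˡ ε)

  Σ-∙ : ∀ {k} (f g : Fin k → Carrier) → Σ (λ i → f i ∙ g i) ≈ Σ f ∙ Σ g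
  Σ-∙ {zero}  f g = sym (identityˡ ε)
  Σ-∙ {suc k} f g = trans (∙-congˡ (Σ-∙ (λ i → f (suc i)) (λ i → g (suc i)))) (interchange _ _ _ _)

  Σ-swap : ∀ {k l} (f : Fin k → Fin l → Carrier) → Σ (λ i → Σ (λ j → f i j)) ≈ Σ (λ j → Σ (λ i → f i j))
  Σ-swap {zero} {l} f = sym (Σ-ε {l} (λ _ → refl))
  Σ-swap {suc k} f = trans (∙-congˡ (Σ-swap (λ i → f (suc i)))) (sym (Σ-∙ (f zero) _))

  Σ-init-last : ∀ {k} (f : Fin (suc k) → Carrier) → Σ f ≈ Σ (λ i → f (inject₁ i)) ∙ f (fromℕ k)
  Σ-init-last {zero}  f = trans (identityʳ _) (sym (identityˡ _))
  Σ-init-last {suc k} f = trans (∙-congˡ (Σ-init-last (λ i → f (suc i)))) (sym (assoc _ _ _))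

  sumℤ-· : ∀ {k} (f : Fin k → ℤ) x → sumℤ f · x ≈ Σ (λ r → f r · x)
  sumℤ-· {zero}  f x = refl
  sumℤ-· {suc k} f x = trans (+-· (f zero) _ x) (∙-congˡ (sumℤ-· (λ r → f (suc r)) x))

  Σ-δ : ∀ {k} (c : ℤ) (p : Fin k) (h : Fin k → Carrier) → Σ (λ i → (c * δ p i) · h i) ≈ c · h p
  Σ-δ {suc k} c zero    h =
    trans (∙-cong (·-congˡ (h zero) (ℤP.*-identityʳ c))
                  (Σ-ε (λ i → trans (·-congˡ (h (suc i)) (ℤP.*-zeroʳ c)) refl)))
          (identityʳ _)
  Σ-δ {suc k} c (suc p) h =
    trans (∙-congʳ (·-congˡ (h zero) (ℤP.*-zeroʳ c))) (trans (identityˡ _) (Σ-δ c p (λ i → h (suc i))))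

  Σ-combo : ∀ {r k} (c : Fin r → ℤ) (p : Fin r → Fin k) (h : Fin k → Carrier) →
    Σ (λ i → combo c p i · h i) ≈ Σ (λ t → c t · h (p t))
  Σ-combo c p h = begin
    Σ (λ i → combo c p i · h i)               ≈⟨ Σ-cong (λ i → sumℤ-· (λ t → c t * δ (p t) i) (h i)) ⟩
    Σ (λ i → Σ (λ t → (c t * δ (p t) i) · h i)) ≈⟨ Σ-swap (λ i t → (c t * δ (p t) i) · h i) ⟩
    Σ (λ t → Σ (λ i → (c t * δ (p t) i) · h i)) ≈⟨ Σ-cong (λ t → Σ-δ (c t) (p t) h) ⟩
    Σ (λ t → c t · h (p t))                   ∎

  unit-relation : ∀ {u} a b → Unit u → u · a ∙ (- u) · b ≈ ε → a ≈ b
  unit-relation a b (inj₁ ≡.refl) rel =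
    x∙y⁻¹≈ε⇒x≈y a b (trans (∙-cong (sym (1· a)) (sym (-1· b))) rel)
  unit-relation a b (inj₂ ≡.refl) rel =
    sym (x∙y⁻¹≈ε⇒x≈y b a (trans (comm _ _) (trans (∙-cong (sym (-1· a)) (sym (1· b))) rel)))

  quad-relation : ∀ a b c d → a ∙ b ≈ c ∙ d → Σ (λ t → signs t · corners a b c d t) ≈ ε
  quad-relation a b c d a∙b≈c∙d = begin
    1ℤ · a ∙ (1ℤ · b ∙ ((- 1ℤ) · c ∙ ((- 1ℤ) · d ∙ ε)))
      ≈⟨ ∙-cong (1· a) (∙-cong (1· b) (∙-cong (-1· c) (trans (identityʳ _) (-1· d)))) ⟩
    a ∙ (b ∙ (c ⁻¹ ∙ d ⁻¹)) ≈⟨ assoc _ _ _ ⟨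
    (a ∙ b) ∙ (c ⁻¹ ∙ d ⁻¹) ≈⟨ ∙-cong a∙b≈c∙d (⁻¹-∙-comm c d) ⟩
    (c ∙ d) ∙ (c ∙ d) ⁻¹    ≈⟨ inverseʳ _ ⟩
    ε                       ∎

data InitOrLast {n : ℕ} : Fin (suc n) → Set where
  init : (i : Fin n) → InitOrLast (inject₁ i)
  last : InitOrLast (fromℕ n)

initOrLast : ∀ {n} (i : Fin (suc n)) → InitOrLast i
initOrLast {zero}  zero    = last
initOrLast {suc n} zero    = init zero
initOrLast {suc n} (suc i) with initOrLast i
... | init j = init (suc j)
... | last   = last

module ListingFacts {A : AbelianGroup 0ℓ 0ℓ} (L : Listing A) where
  open AbelianGroup A hiding (_-_)
  open Listing L
  open GroupSums A

  extend : ∀ {k} → (Fin k → Carrier) → Fin (suc k) → Carrier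
  extend {zero}  h zero    = ε
  extend {suc k} h zero    = h zero
  extend {suc k} h (suc i) = extend (λ j → h (suc j)) i

  extend-init : ∀ {k} (h : Fin k → Carrier) i → extend h (inject₁ i) ≡ h i
  extend-init {suc k} h zero    = ≡.refl
  extend-init {suc k} h (suc i) = extend-init (λ j → h (suc j)) i

  extend-last : ∀ {k} (h : Fin k → Carrier) → extend h (fromℕ k) ≡ ε
  extend-last {zero}  h = ≡.refl
  extend-last {suc k} h = extend-last (λ j → h (suc j))

  -- ĝ i is the element attached to the i-th coordinate of 𝓛(A); it
  -- enumerates A without repetition.
  ĝ : Fin (suc n) → Carrier
  ĝ = extend g

  ĝ-init : ∀ i → ĝ (inject₁ i) ≈ g i
  ĝ-init i = reflexive (extend-init g i)

  ĝ-last : ĝ (fromℕ n) ≈ ε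
  ĝ-last = reflexive (extend-last g)

  ĝ-injective : ∀ i j → ĝ i ≈ ĝ j → i ≡ j
  ĝ-injective i j ĝi≈ĝj with initOrLast i | initOrLast j
  ... | init a | init b = ≡.cong inject₁ (g-inj a b (trans (sym (ĝ-init a)) (trans ĝi≈ĝj (ĝ-init b))))
  ... | init a | last   = ⊥-elim (g-nonzero a (trans (sym (ĝ-init a)) (trans ĝi≈ĝj ĝ-last)))
  ... | last   | init b = ⊥-elim (g-nonzero b (trans (sym (ĝ-init b)) (trans (sym ĝi≈ĝj) ĝ-last)))
  ... | last   | last   = ≡.refl

  ĝ≈ε? : ∀ i → Dec (ĝ i ≈ ε)
  ĝ≈ε? i with initOrLast i
  ... | init a = no (λ ĝa≈ε → g-nonzero a (trans (sym (ĝ-init a)) ĝa≈ε))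
  ... | last   = yes ĝ-last

  locate : ∀ a → Dec (a ≈ ε) → ∃ λ i → ĝ i ≈ a
  locate a (yes a≈ε) = fromℕ n , trans ĝ-last (sym a≈ε)
  locate a (no a≉ε) with g-surj a a≉ε
  ... | i , a≈gi = inject₁ i , trans (ĝ-init i) (sym a≈gi)

  lattice-sum : ∀ {X} → InLattice L X → sumℤ X ≡ 0ℤ
  lattice-sum {X} (last≡ , _) =
    ≡.trans (sumℤ-init-last X)
            (≡.trans (≡.cong (_+_ (sumℤ (λ i → X (inject₁ i)))) last≡) (ℤP.+-inverseʳ (sumℤ (λ i → X (inject₁ i)))))

  Σ-ĝ : ∀ (X : Fin (suc n) → ℤ) → Σ (λ i → X i · ĝ i) ≈ Σ (λ i → X (inject₁ i) · g i)
  Σ-ĝ X = begin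
    Σ (λ i → X i · ĝ i)
      ≈⟨ Σ-init-last (λ i → X i · ĝ i) ⟩
    Σ (λ i → X (inject₁ i) · ĝ (inject₁ i)) ∙ X (fromℕ n) · ĝ (fromℕ n)
      ≈⟨ ∙-cong (Σ-cong (λ i → ·-congʳ (X (inject₁ i)) (ĝ-init i)))
                (trans (·-congʳ (X (fromℕ n)) ĝ-last) (·-ε (X (fromℕ n)))) ⟩
    Σ (λ i → X (inject₁ i) · g i) ∙ ε
      ≈⟨ identityʳ _ ⟩
    Σ (λ i → X (inject₁ i) · g i) ∎
    where open import Relation.Binary.Reasoning.Setoid setoid

  lattice-relation : ∀ {X} → InLattice L X → Σ (λ i → X i · ĝ i) ≈ ε
  lattice-relation {X} (_ , rel) = trans (Σ-ĝ X) rel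

  lattice-intro : ∀ (X : Fin (suc n) → ℤ) → sumℤ X ≡ 0ℤ → Σ (λ i → X i · ĝ i) ≈ ε → InLattice L X
  lattice-intro X sum≡0 rel =
    sum≡0⇒≡- _ _ (≡.trans (≡.sym (sumℤ-init-last X)) sum≡0) , trans (sym (Σ-ĝ X)) rel

  combo-in-lattice : ∀ {r} (c : Fin r → ℤ) (p : Fin r → Fin (suc n)) →
    sumℤ c ≡ 0ℤ → Σ (λ t → c t · ĝ (p t)) ≈ ε → InLattice L (combo c p)
  combo-in-lattice c p sum≡0 rel =
    lattice-intro (combo c p) (≡.trans (combo-sum c p) sum≡0) (trans (Σ-combo c p ĝ) rel)

  -- A nonzero coordinate of a lattice vector is never the only one, as the sum is 0.
  second-nonzero : ∀ {X} → InLattice L X → ∀ i → ¬ X i ≡ 0ℤ → ∃ λ j → ¬ j ≡ i × ¬ X j ≡ 0ℤ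
  second-nonzero {X} X∈L i Xi≢0 with any? (λ j → ¬? (j ≟ᶠ i) ×-dec ¬? (X j ℤP.≟ 0ℤ))
  ... | yes found = found
  ... | no  none  = ⊥-elim (Xi≢0 Xi≡0)
    where
    off : ∀ l → (∀ t → ¬ single i t ≡ l) → X l ≡ 0ℤ
    off l l∉ = decidable-stable (X l ℤP.≟ 0ℤ) (λ Xl≢0 → none (l , (λ l≡i → l∉ zero (≡.sym l≡i)) , Xl≢0))
    Xi≡0 : X i ≡ 0ℤ
    Xi≡0 = begin
      X i                                         ≡⟨ ℤP.+-identityʳ (X i) ⟨
      sumℤ (λ t → X (single i t))                 ≡⟨ combo-sum (λ t → X (single i t)) (single i) ⟨
      sumℤ (combo (λ t → X (single i t)) (single i)) ≡⟨ sumℤ-cong (support-combo X (single i) (single-injective i) off) ⟨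
      sumℤ X                                      ≡⟨ lattice-sum {X} X∈L ⟩
      0ℤ                                          ∎
      where open ≡.≡-Reasoning

  -- A lattice vector supported on two coordinates i ≠ j with X_i = ±1
  -- would be e_i - e_j (or its negative), forcing ĝ i = ĝ j.
  no-unit-pair : ∀ {X} → InLattice L X → ∀ i j → ¬ i ≡ j → Unit (X i) →
    (∀ l → ¬ l ≡ i → ¬ l ≡ j → X l ≡ 0ℤ) → ⊥
  no-unit-pair {X} X∈L i j i≢j unit off =
    i≢j (ĝ-injective i j (unit-relation (ĝ i) (ĝ j) unit relation))
    where
    X≗pair : ∀ l → X l ≡ combo (λ t → X (pair i j t)) (pair i j) l
    X≗pair = support-combo X (pair i j) (pair-injective i≢j)
               (λ l l∉ → off l (λ l≡i → l∉ zero (≡.sym l≡i)) (λ l≡j → l∉ (suc zero) (≡.sym l≡j)))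
    Xj≡ : X j ≡ - X i
    Xj≡ = ≡.trans (≡.sym (ℤP.+-identityʳ (X j))) (sum≡0⇒≡- (X i) (X j + 0ℤ) (begin
      X i + (X j + 0ℤ)                                  ≡⟨ combo-sum (λ t → X (pair i j t)) (pair i j) ⟨
      sumℤ (combo (λ t → X (pair i j t)) (pair i j))    ≡⟨ sumℤ-cong X≗pair ⟨
      sumℤ X                                            ≡⟨ lattice-sum {X} X∈L ⟩
      0ℤ                                                ∎))
      where open ≡.≡-Reasoning
    relation : X i · ĝ i ∙ (- X i) · ĝ j ≈ ε
    relation = begin
      X i · ĝ i ∙ (- X i) · ĝ j                                 ≈⟨ ∙-congˡ (·-congˡ (ĝ j) (≡.sym Xj≡)) ⟩
      X i · ĝ i ∙ X j · ĝ j                                     ≈⟨ ∙-congˡ (identityʳ _) ⟨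
      Σ (λ t → X (pair i j t) · ĝ (pair i j t))                 ≈⟨ Σ-combo (λ t → X (pair i j t)) (pair i j) ĝ ⟨
      Σ (λ l → combo (λ t → X (pair i j t)) (pair i j) l · ĝ l) ≈⟨ Σ-cong (λ l → ·-congˡ (ĝ l) (X≗pair l)) ⟨
      Σ (λ l → X l · ĝ l)                                       ≈⟨ lattice-relation {X} X∈L ⟩
      ε                                                         ∎
      where open import Relation.Binary.Reasoning.Setoid setoid

  -- The bound d(A) ≥ 2.  If ‖X‖² < 4 all nonzero coordinates are ±1; a third
  -- one gives ‖X‖² ≥ 3, hence ≥ 4 by parity, and otherwise no-unit-pair applies.
  norm-≥4 : ∀ {X} → InLattice L X → NonZeroVec X → + 4 ≤ ‖ X ‖²
  norm-≥4 {X} X∈L (i , Xi≢0) with second-nonzero X∈L i Xi≢0 | + 4 ℤP.≤? ‖ X ‖²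
  ... | _              | yes big  = big
  ... | j , j≢i , Xj≢0 | no small =
    ⊥-elim (by-support (any? (λ l → ¬? (l ≟ᶠ i) ×-dec (¬? (l ≟ᶠ j) ×-dec ¬? (X l ℤP.≟ 0ℤ)))))
    where
    squares≥0 : ∀ l → 0ℤ ≤ X l * X l
    squares≥0 l = square-nonneg (X l)
    unit : ∀ l → ¬ X l ≡ 0ℤ → Unit (X l)
    unit l Xl≢0 with unit-or-big (X l) Xl≢0
    ... | inj₁ u   = u
    ... | inj₂ big = ⊥-elim (small (ℤP.≤-trans big (term-≤-sum (λ t → X t * X t) squares≥0 l)))
    by-support : Dec (∃ λ l → ¬ l ≡ i × ¬ l ≡ j × ¬ X l ≡ 0ℤ) → ⊥
    by-support (yes (l , l≢i , l≢j , Xl≢0)) = small (even-≥3⇒≥4 (norm-even X (lattice-sum {X} X∈L)) three≤)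
      where
      three≤ : + 3 ≤ ‖ X ‖²
      three≤ = ≡.subst (_≤ ‖ X ‖²)
        (≡.cong₂ _+_ (≡.cong₂ _+_ (unit-square (unit i Xi≢0)) (unit-square (unit j Xj≢0))) (unit-square (unit l Xl≢0)))
        (three-terms-≤-sum (λ t → X t * X t) squares≥0 i j l
          (λ i≡j → j≢i (≡.sym i≡j)) (λ i≡l → l≢i (≡.sym i≡l)) (λ j≡l → l≢j (≡.sym j≡l)))
    by-support (no none) = no-unit-pair X∈L i j (λ i≡j → j≢i (≡.sym i≡j)) (unit i Xi≢0)
      (λ l l≢i l≢j → decidable-stable (X l ℤP.≟ 0ℤ) (λ Xl≢0 → none (l , l≢i , l≢j , Xl≢0)))

  min-dist-2 : ∀ X → InLattice L X → NonZeroVec X → ‖ X ‖² ≡ + 4 → MinDist L 2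
  min-dist-2 X X∈L X≢0 ‖X‖²≡4 = (X , X∈L , X≢0 , ‖X‖²≡4) , (λ Y Y∈L Y≢0 → norm-≥4 Y∈L Y≢0)

  min-unique : ∀ {δ δ′} → MinNormSq L δ → MinNormSq L δ′ → δ ≡ δ′
  min-unique ((X , X∈L , X≢0 , ‖X‖²≡δ) , δ-min) ((Y , Y∈L , Y≢0 , ‖Y‖²≡δ′) , δ′-min) =
    ℤP.≤-antisym (≡.subst (_ ≤_) ‖Y‖²≡δ′ (δ-min Y Y∈L Y≢0)) (≡.subst (_ ≤_) ‖X‖²≡δ (δ′-min X X∈L X≢0))

module ProductSums (A B : AbelianGroup 0ℓ 0ℓ) where
  private
    module A = AbelianGroup A
    module B = AbelianGroup B
    module ΣA = GroupSums A
    module ΣB = GroupSums B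
    module ΣH = GroupSums (abelianGroup A B)
  open AbelianGroup (abelianGroup A B)

  ·-pair : ∀ z a b → z ΣH.· (a , b) ≡ (z ΣA.· a , z ΣB.· b)
  ·-pair (+ n)    a b = natmul-pair n
    where
    natmul-pair : ∀ n → natmul (abelianGroup A B) n (a , b) ≡ (natmul A n a , natmul B n b)
    natmul-pair zero    = ≡.refl
    natmul-pair (suc n) = ≡.cong ((a , b) ∙_) (natmul-pair n)
  ·-pair -[1+ n ] a b = ≡.cong _⁻¹ (·-pair (+ suc n) a b)

  Σ-pair : ∀ {k} (f : Fin k → Carrier) → ΣH.Σ f ≡ (ΣA.Σ (λ t → proj₁ (f t)) , ΣB.Σ (λ t → proj₂ (f t)))
  Σ-pair {zero}  f = ≡.refl
  Σ-pair {suc k} f = ≡.cong (f zero ∙_) (Σ-pair (λ t → f (suc t)))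

  relation-pair : ∀ {r} (c : Fin r → ℤ) (a : Fin r → A.Carrier) (b : Fin r → B.Carrier) →
    ΣA.Σ (λ t → c t ΣA.· a t) A.≈ A.ε → ΣB.Σ (λ t → c t ΣB.· b t) B.≈ B.ε →
    ΣH.Σ (λ t → c t ΣH.· (a t , b t)) ≈ ε
  relation-pair c a b relA relB = trans (reflexive (Σ-pair (λ t → c t ΣH.· (a t , b t))))
    ( A.trans (ΣA.Σ-cong {f = λ t → proj₁ (c t ΣH.· (a t , b t))} {g = λ t → c t ΣA.· a t}
                         (λ t → A.reflexive (≡.cong proj₁ (·-pair (c t) (a t) (b t))))) relA
    , B.trans (ΣB.Σ-cong {f = λ t → proj₂ (c t ΣH.· (a t , b t))} {g = λ t → c t ΣB.· b t}
                         (λ t → B.reflexive (≡.cong proj₂ (·-pair (c t) (a t) (b t))))) relB )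

private
  residue-unique-≤ : ∀ m {a b} → a ℕ.< m → b ℕ.≤ a → + m ∣ (+ a - + b) → a ≡ b
  residue-unique-≤ m {a} {b} a<m b≤a m∣a-b with a ℕ.∸ b in a∸b≡
  ... | zero  = ℕP.≤-antisym (ℕP.m∸n≡0⇒m≤n a∸b≡) b≤a
  ... | suc d = ⊥-elim (ℕD.>⇒∤ (ℕP.≤-<-trans (ℕP.≤-trans (ℕP.≤-reflexive (≡.sym a∸b≡)) (ℕP.m∸n≤m a b)) a<m)
                                 (≡.subst (λ z → m ℕD.∣ ℤ.∣ z ∣) diff (∣⇒∣ᵤ m∣a-b)))
    where
    diff : + a - + b ≡ + suc d
    diff = ≡.trans (ℤP.m-n≡m⊖n a b) (≡.trans (ℤP.⊖-≥ b≤a) (≡.cong +_ a∸b≡))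

residue-unique : ∀ m {a b} → a ℕ.< m → b ℕ.< m → + m ∣ (+ a - + b) → a ≡ b
residue-unique m {a} {b} a<m b<m m∣a-b with ℕP.≤-total b a
... | inj₁ b≤a = residue-unique-≤ m a<m b≤a m∣a-b
... | inj₂ a≤b = ≡.sym (residue-unique-≤ m b<m a≤b (≡.subst (+ m ∣_) (flip (+ a) (+ b)) (∣m⇒∣-m m∣a-b)))
  where
  flip : ∀ x y → - (x - y) ≡ y - x
  flip = solve-∀

finite-decisions : ∀ {k} (Q : Fin k → Set) → ¬ ¬ (∀ t → Dec (Q t))
finite-decisions {zero}  Q no-decisions = no-decisions (λ ())
finite-decisions {suc k} Q no-decisions =
  ¬¬-excluded-middle (λ dec₀ → finite-decisions (λ t → Q (suc t))
    (λ dec → no-decisions (λ { zero → dec₀ ; (suc t) → dec t })))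

module Residues (R : ℕ) where
  m : ℕ
  m = suc R

  [m∣_] : ℤ → ℤ
  [m∣ k ] with + m ∣? k
  ... | yes _ = 1ℤ
  ... | no  _ = 0ℤ

  [m∣]-yes : ∀ {k} → + m ∣ k → [m∣ k ] ≡ 1ℤ
  [m∣]-yes {k} m∣k with + m ∣? k
  ... | yes _  = ≡.refl
  ... | no m∤k = ⊥-elim (m∤k m∣k)

  [m∣]-no : ∀ {k} → ¬ (+ m ∣ k) → [m∣ k ] ≡ 0ℤ
  [m∣]-no {k} m∤k with + m ∣? k
  ... | yes m∣k = ⊥-elim (m∤k m∣k)
  ... | no _    = ≡.refl

  κ : Fin R → ℤ
  κ r = + suc (toℕ r)

  κ-nonzero : ∀ r → ¬ (+ m ∣ κ r)
  κ-nonzero r m∣κ = ℕD.>⇒∤ (s≤s (toℕ<n r)) (∣⇒∣ᵤ m∣κ)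

  ∤-neg : ∀ {a b} → ¬ (+ m ∣ a) → - a ≡ b → ¬ (+ m ∣ b)
  ∤-neg m∤a -a≡b m∣b = m∤a (≡.subst (+ m ∣_) (ℤP.neg-involutive _) (∣m⇒∣-m (≡.subst (+ m ∣_) (≡.sym -a≡b) m∣b)))

  ∤-0 : ∀ {k} → ¬ (+ m ∣ k) → ¬ (+ m ∣ (k - 0ℤ))
  ∤-0 {k} m∤k m∣ = m∤k (≡.subst (+ m ∣_) (ℤP.+-identityʳ k) m∣)

  0-∤ : ∀ {k} → ¬ (+ m ∣ k) → ¬ (+ m ∣ (0ℤ - k))
  0-∤ {k} m∤k = ∤-neg m∤k (≡.sym (ℤP.+-identityˡ (- k)))

  ∤-2 : ∀ {k} → ¬ (+ m ∣ k) → ¬ (+ m ∣ (k - + 2 * k))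
  ∤-2 {k} m∤k = ∤-neg m∤k (minus k)
    where
    minus : ∀ k → - k ≡ k - + 2 * k
    minus = solve-∀

  residue : ℤ → Fin m
  residue z = fromℕ< (n%d<d z (+ m))

  residue-≡ : ∀ z z′ → residue z ≡ residue z′ → + m ∣ (z - z′)
  residue-≡ z z′ same = divides (z / + m - z′ / + m) (begin
    z - z′
      ≡⟨ ≡.cong₂ _-_ (a≡a%n+[a/n]*n z (+ m)) (a≡a%n+[a/n]*n z′ (+ m)) ⟩
    (+ (z % + m) + z / + m * + m) - (+ (z′ % + m) + z′ / + m * + m)
      ≡⟨ ≡.cong (λ r → (+ r + z / + m * + m) - (+ (z′ % + m) + z′ / + m * + m)) same% ⟩
    (+ (z′ % + m) + z / + m * + m) - (+ (z′ % + m) + z′ / + m * + m)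
      ≡⟨ cancel (+ (z′ % + m)) (z / + m) (z′ / + m) (+ m) ⟩
    (z / + m - z′ / + m) * + m ∎)
    where
    open ≡.≡-Reasoning
    same% : z % + m ≡ z′ % + m
    same% = ≡.trans (≡.sym (toℕ-fromℕ< (n%d<d z (+ m)))) (≡.trans (≡.cong toℕ same) (toℕ-fromℕ< (n%d<d z′ (+ m))))
    cancel : ∀ r a b c → (r + a * c) - (r + b * c) ≡ (a - b) * c
    cancel = solve-∀

  [m∣κ-κ] : ∀ r r′ → [m∣ κ r - κ r′ ] ≡ δ r r′
  [m∣κ-κ] r r′ with r ≟ᶠ r′
  ... | yes ≡.refl = ≡.trans ([m∣]-yes (≡.subst (+ m ∣_) (≡.sym (ℤP.+-inverseʳ (κ r))) (divides 0ℤ ≡.refl)))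
                             (≡.sym (δ-diag r))
  ... | no r≢r′    = ≡.trans ([m∣]-no (λ m∣ → r≢r′ (toℕ-injective (ℕP.suc-injective
                                (residue-unique m (s≤s (toℕ<n r)) (s≤s (toℕ<n r′)) m∣)))))
                             (≡.sym (δ-off r≢r′))

  -- The doubling system on the nonzero residues, 2 v_s = Σ_{r : 2κ_r ≡ κ_s} v_r,
  -- has only the zero solution; this is where the restriction on m enters.
  DoublingRigid : Set
  DoublingRigid = ∀ (v : Fin R → ℤ) → (∀ s → + 2 * v s ≡ sumℤ (λ r → v r * [m∣ + 2 * κ r - κ s ])) →
    ∀ r → v r ≡ 0ℤ

-- The group H = ℤ_m × G, with m = R + 1, listings of G and of H, and the
-- position ρ k x of the element (k, ĝ x) among the coordinates of 𝓛(H).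
module Product (R : ℕ) (G : AbelianGroup 0ℓ 0ℓ) (LG : Listing G) (LH : Listing (suc R ⊗ G)) where
  open Residues R public

  H : AbelianGroup 0ℓ 0ℓ
  H = m ⊗ G

  module Gr = AbelianGroup G
  module Hr = AbelianGroup H
  module ΣG = GroupSums G
  module ΣH = GroupSums H
  module 𝓛G = ListingFacts LG
  module 𝓛H = ListingFacts LH
  open ProductSums (ℤ/ m) G public using (relation-pair)

  nG : ℕ
  nG = Listing.n LG

  N : ℕ
  N = Listing.n LH

  ρ : ℤ → Fin (suc nG) → Fin (suc N)
  ρ k x = proj₁ (𝓛H.locate (k , 𝓛G.ĝ x) ((+ m ∣? (k - 0ℤ)) ×-dec 𝓛G.ĝ≈ε? x))

  ρ-spec : ∀ k x → 𝓛H.ĝ (ρ k x) Hr.≈ (k , 𝓛G.ĝ x)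
  ρ-spec k x = proj₂ (𝓛H.locate (k , 𝓛G.ĝ x) ((+ m ∣? (k - 0ℤ)) ×-dec 𝓛G.ĝ≈ε? x))

  ρ-injective : ∀ k x k′ x′ → ρ k x ≡ ρ k′ x′ → + m ∣ (k - k′) × x ≡ x′
  ρ-injective k x k′ x′ ρ≡ =
    let (m∣k-k′ , ĝx≈ĝx′) = same-element in m∣k-k′ , 𝓛G.ĝ-injective x x′ ĝx≈ĝx′
    where
    open import Relation.Binary.Reasoning.Setoid Hr.setoid
    same-element : (k , 𝓛G.ĝ x) Hr.≈ (k′ , 𝓛G.ĝ x′)
    same-element = begin
      (k , 𝓛G.ĝ x)      ≈⟨ ρ-spec k x ⟨
      𝓛H.ĝ (ρ k x)      ≡⟨ ≡.cong 𝓛H.ĝ ρ≡ ⟩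
      𝓛H.ĝ (ρ k′ x′)    ≈⟨ ρ-spec k′ x′ ⟩
      (k′ , 𝓛G.ĝ x′)    ∎

  ρ-mod : ∀ k k′ x → + m ∣ (k - k′) → ρ k x ≡ ρ k′ x
  ρ-mod k k′ x m∣k-k′ = 𝓛H.ĝ-injective (ρ k x) (ρ k′ x) (begin
    𝓛H.ĝ (ρ k x)      ≈⟨ ρ-spec k x ⟩
    (k , 𝓛G.ĝ x)      ≈⟨ m∣k-k′ , Gr.refl ⟩
    (k′ , 𝓛G.ĝ x)     ≈⟨ ρ-spec k′ x ⟨
    𝓛H.ĝ (ρ k′ x)     ∎)
    where open import Relation.Binary.Reasoning.Setoid Hr.setoid

  δ-ρ : ∀ k x k′ x′ → δ (ρ k x) (ρ k′ x′) ≡ [m∣ k - k′ ] * δ x x′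
  δ-ρ k x k′ x′ = by-cases (+ m ∣? (k - k′)) (x ≟ᶠ x′)
    where
    by-cases : Dec (+ m ∣ (k - k′)) → Dec (x ≡ x′) → δ (ρ k x) (ρ k′ x′) ≡ [m∣ k - k′ ] * δ x x′
    by-cases (yes m∣) (yes ≡.refl) =
      ≡.trans (≡.subst (λ i → δ (ρ k x) i ≡ 1ℤ) (ρ-mod k k′ x m∣) (δ-diag (ρ k x)))
              (≡.sym (≡.trans (≡.cong (_* δ x x) ([m∣]-yes m∣)) (≡.trans (ℤP.*-identityˡ (δ x x)) (δ-diag x))))
    by-cases (yes m∣) (no x≢x′) =
      ≡.trans (δ-off (λ ρ≡ → x≢x′ (proj₂ (ρ-injective k x k′ x′ ρ≡))))
              (≡.sym (≡.trans (≡.cong ([m∣ k - k′ ] *_) (δ-off x≢x′)) (ℤP.*-zeroʳ [m∣ k - k′ ])))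
    by-cases (no m∤) _ =
      ≡.trans (δ-off (λ ρ≡ → m∤ (proj₁ (ρ-injective k x k′ x′ ρ≡)))) (≡.sym (≡.cong (_* δ x x′) ([m∣]-no m∤)))

  -- The positions ρ give an
  -- injection ℤ_m × G → H; conversely (r, x) ↦ (r mod m, position of x) is
  -- an injection H → ℤ_m × G once we can decide which elements of G are 0,
  -- which is possible up to double negation, enough for an inequality in ℕ.

  ℤm×G→H : Fin (m ℕ.* suc nG) → Fin (suc N)
  ℤm×G→H t = uncurry (λ r x → ρ (+ toℕ r) x) (remQuot {m} (suc nG) t)

  ℤm×G→H-injective : Injective _≡_ _≡_ ℤm×G→H
  ℤm×G→H-injective {s} {t} same =
    ≡.trans (≡.sym (combine-remQuot {m} (suc nG) s))
            (≡.trans (≡.cong (uncurry combine) (≡.cong₂ _,_ same-r (proj₂ same-pos))) (combine-remQuot {m} (suc nG) t))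
    where
    r₁ r₂ : Fin m
    r₁ = proj₁ (remQuot {m} (suc nG) s)
    r₂ = proj₁ (remQuot {m} (suc nG) t)
    x₁ x₂ : Fin (suc nG)
    x₁ = proj₂ (remQuot {m} (suc nG) s)
    x₂ = proj₂ (remQuot {m} (suc nG) t)
    same-pos : + m ∣ (+ toℕ r₁ - + toℕ r₂) × x₁ ≡ x₂
    same-pos = ρ-injective (+ toℕ r₁) x₁ (+ toℕ r₂) x₂ same
    same-r : r₁ ≡ r₂
    same-r = toℕ-injective (residue-unique m (toℕ<n r₁) (toℕ<n r₂) (proj₁ same-pos))

  module _ (zero? : ∀ t → Dec (proj₂ (𝓛H.ĝ t) Gr.≈ Gr.ε)) where
    H→ℤm×G : Fin (suc N) → Fin (m ℕ.* suc nG)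
    H→ℤm×G t = combine (residue (proj₁ (𝓛H.ĝ t))) (proj₁ (𝓛G.locate (proj₂ (𝓛H.ĝ t)) (zero? t)))

    H→ℤm×G-injective : Injective _≡_ _≡_ H→ℤm×G
    H→ℤm×G-injective {s} {t} same =
      𝓛H.ĝ-injective s t (residue-≡ (proj₁ (𝓛H.ĝ s)) (proj₁ (𝓛H.ĝ t)) (proj₁ split) , same-G)
      where
      y₁ y₂ : Fin (suc nG)
      y₁ = proj₁ (𝓛G.locate (proj₂ (𝓛H.ĝ s)) (zero? s))
      y₂ = proj₁ (𝓛G.locate (proj₂ (𝓛H.ĝ t)) (zero? t))
      split : residue (proj₁ (𝓛H.ĝ s)) ≡ residue (proj₁ (𝓛H.ĝ t)) × y₁ ≡ y₂
      split = combine-injective (residue (proj₁ (𝓛H.ĝ s))) y₁ (residue (proj₁ (𝓛H.ĝ t))) y₂ same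
      same-G : proj₂ (𝓛H.ĝ s) Gr.≈ proj₂ (𝓛H.ĝ t)
      same-G = Gr.trans (Gr.sym (proj₂ (𝓛G.locate (proj₂ (𝓛H.ĝ s)) (zero? s))))
                 (Gr.trans (Gr.reflexive (≡.cong 𝓛G.ĝ (proj₂ split))) (proj₂ (𝓛G.locate (proj₂ (𝓛H.ĝ t)) (zero? t))))

  order : suc N ≡ m ℕ.* suc nG
  order = ℕP.≤-antisym
    (decidable-stable (suc N ℕP.≤? m ℕ.* suc nG)
       (λ N≰ → finite-decisions (λ t → proj₂ (𝓛H.ĝ t) Gr.≈ Gr.ε)
                 (λ zero? → N≰ (injective⇒≤ {f = H→ℤm×G zero?} (H→ℤm×G-injective zero?)))))
    (injective⇒≤ {f = ℤm×G→H} ℤm×G→H-injective)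

module Construction (R : ℕ) (G : AbelianGroup 0ℓ 0ℓ) (LG : Listing G) (LH : Listing (suc R ⊗ G)) where
  open Product R G LG LH public

  o : Fin (suc nG)
  o = fromℕ nG

  ι : Fin nG → Fin (suc nG)
  ι = inject₁

  ρ-apart-x : ∀ k x k′ x′ → ¬ x ≡ x′ → ¬ ρ k x ≡ ρ k′ x′
  ρ-apart-x k x k′ x′ x≢x′ ρ≡ = x≢x′ (proj₂ (ρ-injective k x k′ x′ ρ≡))

  ρ-apart-k : ∀ k x k′ x′ → ¬ (+ m ∣ (k - k′)) → ¬ ρ k x ≡ ρ k′ x′
  ρ-apart-k k x k′ x′ m∤ ρ≡ = m∤ (proj₁ (ρ-injective k x k′ x′ ρ≡))

  quad-ρ-at : ∀ k₀ x₀ k₁ x₁ k₂ x₂ k₃ x₃ k y →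
    quad (ρ k₀ x₀) (ρ k₁ x₁) (ρ k₂ x₂) (ρ k₃ x₃) (ρ k y) ≡
    [m∣ k₀ - k ] * δ x₀ y + [m∣ k₁ - k ] * δ x₁ y - [m∣ k₂ - k ] * δ x₂ y - [m∣ k₃ - k ] * δ x₃ y
  quad-ρ-at k₀ x₀ k₁ x₁ k₂ x₂ k₃ x₃ k y =
    ≡.trans (quad-at (ρ k₀ x₀) (ρ k₁ x₁) (ρ k₂ x₂) (ρ k₃ x₃) (ρ k y))
            (≡.cong₂ _-_ (≡.cong₂ _-_ (≡.cong₂ _+_ (δ-ρ k₀ x₀ k y) (δ-ρ k₁ x₁ k y)) (δ-ρ k₂ x₂ k y)) (δ-ρ k₃ x₃ k y))

  quad-in-lattice : ∀ k₀ x₀ k₁ x₁ k₂ x₂ k₃ x₃ → k₀ + k₁ ≡ k₂ + k₃ →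
    𝓛G.ĝ x₀ Gr.∙ 𝓛G.ĝ x₁ Gr.≈ 𝓛G.ĝ x₂ Gr.∙ 𝓛G.ĝ x₃ →
    InLattice LH (quad (ρ k₀ x₀) (ρ k₁ x₁) (ρ k₂ x₂) (ρ k₃ x₃))
  quad-in-lattice k₀ x₀ k₁ x₁ k₂ x₂ k₃ x₃ k-rel x-rel =
    𝓛H.combo-in-lattice signs (corners (ρ k₀ x₀) (ρ k₁ x₁) (ρ k₂ x₂) (ρ k₃ x₃)) ≡.refl (begin
      ΣH.Σ (λ t → signs t ΣH.· 𝓛H.ĝ (corners (ρ k₀ x₀) (ρ k₁ x₁) (ρ k₂ x₂) (ρ k₃ x₃) t))
        ≈⟨ ΣH.Σ-cong {f = λ t → signs t ΣH.· 𝓛H.ĝ (corners (ρ k₀ x₀) (ρ k₁ x₁) (ρ k₂ x₂) (ρ k₃ x₃) t)}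
                     {g = λ t → signs t ΣH.· (corners k₀ k₁ k₂ k₃ t , corners ĝx₀ ĝx₁ ĝx₂ ĝx₃ t)}
                     (λ t → ΣH.·-congʳ (signs t) (corner-spec t)) ⟩
      ΣH.Σ (λ t → signs t ΣH.· (corners k₀ k₁ k₂ k₃ t , corners ĝx₀ ĝx₁ ĝx₂ ĝx₃ t))
        ≈⟨ relation-pair signs (corners k₀ k₁ k₂ k₃) (corners ĝx₀ ĝx₁ ĝx₂ ĝx₃)
             (GroupSums.quad-relation (ℤ/ m) k₀ k₁ k₂ k₃ (AbelianGroup.reflexive (ℤ/ m) k-rel))
             (ΣG.quad-relation ĝx₀ ĝx₁ ĝx₂ ĝx₃ x-rel) ⟩
      Hr.ε ∎)
    where
    open import Relation.Binary.Reasoning.Setoid Hr.setoid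
    ĝx₀ ĝx₁ ĝx₂ ĝx₃ : Gr.Carrier
    ĝx₀ = 𝓛G.ĝ x₀
    ĝx₁ = 𝓛G.ĝ x₁
    ĝx₂ = 𝓛G.ĝ x₂
    ĝx₃ = 𝓛G.ĝ x₃
    corner-spec : ∀ t → 𝓛H.ĝ (corners (ρ k₀ x₀) (ρ k₁ x₁) (ρ k₂ x₂) (ρ k₃ x₃) t) Hr.≈
                        (corners k₀ k₁ k₂ k₃ t , corners ĝx₀ ĝx₁ ĝx₂ ĝx₃ t)
    corner-spec zero                   = ρ-spec k₀ x₀
    corner-spec (suc zero)             = ρ-spec k₁ x₁
    corner-spec (suc (suc zero))       = ρ-spec k₂ x₂
    corner-spec (suc (suc (suc zero))) = ρ-spec k₃ x₃

  U : ℤ → Fin nG → Fin (suc N) → ℤ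
  U k i = quad (ρ k (ι i)) (ρ 0ℤ o) (ρ k o) (ρ 0ℤ (ι i))

  -- (k, gᵢ) + (0, 0) = (k, 0) + (0, gᵢ), and for k ≢ 0 the four positions differ.
  U-in-lattice : ∀ k i → InLattice LH (U k i)
  U-in-lattice k i = quad-in-lattice k (ι i) 0ℤ o k o 0ℤ (ι i) ≡.refl (Gr.comm (𝓛G.ĝ (ι i)) (𝓛G.ĝ o))

  U-distinct : ∀ {k} i → ¬ (+ m ∣ k) → Distinct4 (ρ k (ι i)) (ρ 0ℤ o) (ρ k o) (ρ 0ℤ (ι i))
  U-distinct {k} i m∤k = record
    { a≢b = ρ-apart-x k (ι i) 0ℤ o (λ e → fromℕ≢inject₁ (≡.sym e))
    ; a≢c = ρ-apart-x k (ι i) k o (λ e → fromℕ≢inject₁ (≡.sym e))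
    ; a≢d = ρ-apart-k k (ι i) 0ℤ (ι i) (∤-0 m∤k)
    ; b≢c = ρ-apart-k 0ℤ o k o (0-∤ m∤k)
    ; b≢d = ρ-apart-x 0ℤ o 0ℤ (ι i) fromℕ≢inject₁
    ; c≢d = ρ-apart-x k o 0ℤ (ι i) fromℕ≢inject₁
    }

  V : Fin nG → ℤ → Fin (suc N) → ℤ
  V a k = quad (ρ k o) (ρ k (ι a)) (ρ (+ 2 * k) (ι a)) (ρ 0ℤ o)

  -- (k, 0) + (k, gₐ) = (2k, gₐ) + (0, 0), and for k ≢ 0 the four positions differ.
  V-in-lattice : ∀ a k → InLattice LH (V a k)
  V-in-lattice a k = quad-in-lattice k o k (ι a) (+ 2 * k) (ι a) 0ℤ o (double k) (Gr.comm (𝓛G.ĝ o) (𝓛G.ĝ (ι a)))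
    where
    double : ∀ k → k + k ≡ + 2 * k + 0ℤ
    double = solve-∀

  V-distinct : ∀ a {k} → ¬ (+ m ∣ k) → Distinct4 (ρ k o) (ρ k (ι a)) (ρ (+ 2 * k) (ι a)) (ρ 0ℤ o)
  V-distinct a {k} m∤k = record
    { a≢b = ρ-apart-x k o k (ι a) fromℕ≢inject₁
    ; a≢c = ρ-apart-x k o (+ 2 * k) (ι a) fromℕ≢inject₁
    ; a≢d = ρ-apart-k k o 0ℤ o (∤-0 m∤k)
    ; b≢c = ρ-apart-k k (ι a) (+ 2 * k) (ι a) (∤-2 m∤k)
    ; b≢d = ρ-apart-x k (ι a) 0ℤ o (λ e → fromℕ≢inject₁ (≡.sym e))
    ; c≢d = ρ-apart-x (+ 2 * k) (ι a) 0ℤ o (λ e → fromℕ≢inject₁ (≡.sym e))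
    }

  -- W w is the image of a vector w of 𝓛(G) under G ≅ 0 × G ⊆ H.
  W : (Fin (suc nG) → ℤ) → Fin (suc N) → ℤ
  W w = combo w (ρ 0ℤ)

  ρ₀-injective : Injective _≡_ _≡_ (ρ 0ℤ)
  ρ₀-injective {x} {x′} ρ≡ = proj₂ (ρ-injective 0ℤ x 0ℤ x′ ρ≡)

  W-in-lattice : ∀ w → InLattice LG w → InLattice LH (W w)
  W-in-lattice w w∈𝓛 = 𝓛H.combo-in-lattice w (ρ 0ℤ) (𝓛G.lattice-sum {w} w∈𝓛) (begin
    ΣH.Σ (λ y → w y ΣH.· 𝓛H.ĝ (ρ 0ℤ y))
      ≈⟨ ΣH.Σ-cong {f = λ y → w y ΣH.· 𝓛H.ĝ (ρ 0ℤ y)} {g = λ y → w y ΣH.· (0ℤ , 𝓛G.ĝ y)}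
                   (λ y → ΣH.·-congʳ (w y) (ρ-spec 0ℤ y)) ⟩
    ΣH.Σ (λ y → w y ΣH.· (0ℤ , 𝓛G.ĝ y))
      ≈⟨ relation-pair w (λ _ → 0ℤ) 𝓛G.ĝ (GroupSums.Σ-ε (ℤ/ m) {f = λ y → GroupSums._·_ (ℤ/ m) (w y) 0ℤ} (λ y → GroupSums.·-ε (ℤ/ m) (w y)))
                                         (𝓛G.lattice-relation {w} w∈𝓛) ⟩
    Hr.ε ∎)
    where open import Relation.Binary.Reasoning.Setoid Hr.setoid

  W-norm : ∀ w → ‖ W w ‖² ≡ ‖ w ‖²
  W-norm w = norm-combo w (ρ 0ℤ) ρ₀-injective

  W-nonzero : ∀ w → NonZeroVec w → NonZeroVec (W w)
  W-nonzero w (y , wy≢0) = ρ 0ℤ y , λ Wy≡0 → wy≢0 (≡.trans (≡.sym (combo-at w (ρ 0ℤ) ρ₀-injective y)) Wy≡0)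

  Shifted : Fin (suc N) → Set
  Shifted j = ∃ λ r → ∃ λ y → ρ (κ r) y ≡ j

  W-vanishes : ∀ w j → Shifted j → W w j ≡ 0ℤ
  W-vanishes w j (r , y , ≡.refl) =
    combo-outside w (ρ 0ℤ) (ρ (κ r) y) (λ y′ → ρ-apart-k 0ℤ y′ (κ r) y (0-∤ (κ-nonzero r)))

  -- The nG + 1 new vectors attached to each nonzero residue κ r: V a₀ (κ r)
  -- and the U (κ r) i.  Seen on the shifted coordinates they are
  -- independent, provided the doubling system is rigid.
  module Shifted-block (a₀ : Fin nG) where
    â : Fin (suc nG)
    â = ι a₀

    B : Fin R → Fin (suc nG) → Fin (suc N) → ℤ
    B r zero    = V a₀ (κ r)
    B r (suc i) = U (κ r) i

    U-at : ∀ k i k′ y → ¬ (+ m ∣ (0ℤ - k′)) → U k i (ρ k′ y) ≡ [m∣ k - k′ ] * (δ (ι i) y - δ o y)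
    U-at k i k′ y m∤ =
      ≡.trans (quad-ρ-at k (ι i) 0ℤ o k o 0ℤ (ι i) k′ y)
              (≡.trans (≡.cong (λ z → [m∣ k - k′ ] * δ (ι i) y + z * δ o y - [m∣ k - k′ ] * δ o y - z * δ (ι i) y) ([m∣]-no m∤))
                       (collect [m∣ k - k′ ] (δ (ι i) y) (δ o y)))
      where
      collect : ∀ d a b → d * a + 0ℤ * b - d * b - 0ℤ * a ≡ d * (a - b)
      collect = solve-∀

    V-at : ∀ k k′ y → ¬ (+ m ∣ (0ℤ - k′)) →
      V a₀ k (ρ k′ y) ≡ [m∣ k - k′ ] * (δ o y + δ â y) - [m∣ + 2 * k - k′ ] * δ â y
    V-at k k′ y m∤ =
      ≡.trans (quad-ρ-at k o k â (+ 2 * k) â 0ℤ o k′ y)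
              (≡.trans (≡.cong (λ z → [m∣ k - k′ ] * δ o y + [m∣ k - k′ ] * δ â y - [m∣ + 2 * k - k′ ] * δ â y - z * δ o y) ([m∣]-no m∤))
                       (collect [m∣ k - k′ ] [m∣ + 2 * k - k′ ] (δ o y) (δ â y)))
      where
      collect : ∀ d f a b → d * a + d * b - f * b - 0ℤ * a ≡ d * (a + b) - f * b
      collect = solve-∀

    module Coefficients (c : Fin R → Fin (suc nG) → ℤ) where
      v : Fin R → ℤ
      v r = c r zero

      u : Fin R → Fin nG → ℤ
      u r i = c r (suc i)

      S : Fin R → ℤ
      S s = sumℤ (λ r → v r * [m∣ + 2 * κ r - κ s ])

      X : Fin R → Fin (suc nG) → ℤ
      X r y = v r * (δ o y + δ â y) + sumℤ (λ i → u r i * (δ (ι i) y - δ o y))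

      -- On the coordinate (κ s, y), block r contributes X r y if r = s, and
      -- -v r [2κ r ≡ κ s] at y = g; summing over r gives combination-at.
      block-at : ∀ r s y → sumℤ (λ x → c r x * B r x (ρ (κ s) y)) ≡
                 X r y * δ r s + (- δ â y) * (v r * [m∣ + 2 * κ r - κ s ])
      block-at r s y = begin
        v r * V a₀ (κ r) (ρ (κ s) y) + sumℤ (λ i → u r i * U (κ r) i (ρ (κ s) y))
          ≡⟨ ≡.cong₂ _+_ (≡.cong (v r *_) (V-at (κ r) (κ s) y m∤))
                         (sumℤ-cong (λ i → ≡.cong (u r i *_) (U-at (κ r) i (κ s) y m∤))) ⟩
        v r * ([m∣ κ r - κ s ] * A - F * Bâ) + sumℤ (λ i → u r i * ([m∣ κ r - κ s ] * C i))
          ≡⟨ ≡.cong (λ d → v r * (d * A - F * Bâ) + sumℤ (λ i → u r i * (d * C i))) ([m∣κ-κ] r s) ⟩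
        v r * (δ r s * A - F * Bâ) + sumℤ (λ i → u r i * (δ r s * C i))
          ≡⟨ ≡.cong (_+_ (v r * (δ r s * A - F * Bâ)))
               (≡.trans (sumℤ-cong (λ i → swap (u r i) (δ r s) (C i))) (sumℤ-*ˡ (δ r s) (λ i → u r i * C i))) ⟩
        v r * (δ r s * A - F * Bâ) + δ r s * sumℤ (λ i → u r i * C i)
          ≡⟨ arrange (v r) (δ r s) A F Bâ (sumℤ (λ i → u r i * C i)) ⟩
        X r y * δ r s + (- Bâ) * (v r * F) ∎
        where
        open ≡.≡-Reasoning
        m∤ : ¬ (+ m ∣ (0ℤ - κ s))
        m∤ = 0-∤ (κ-nonzero s)
        A Bâ F : ℤ
        A = δ o y + δ â y
        Bâ = δ â y
        F = [m∣ + 2 * κ r - κ s ]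
        C : Fin nG → ℤ
        C i = δ (ι i) y - δ o y
        swap : ∀ a d x → a * (d * x) ≡ d * (a * x)
        swap = solve-∀
        arrange : ∀ v d A F B T → v * (d * A - F * B) + d * T ≡ (v * A + T) * d + (- B) * (v * F)
        arrange = solve-∀

      combination-at : ∀ s y → sumℤ (λ r → sumℤ (λ x → c r x * B r x (ρ (κ s) y))) ≡ X s y + (- δ â y) * S s
      combination-at s y =
        ≡.trans (sumℤ-cong (λ r → block-at r s y))
          (≡.trans (sumℤ-+ (λ r → X r y * δ r s) (λ r → (- δ â y) * (v r * [m∣ + 2 * κ r - κ s ])))
                   (≡.cong₂ _+_ (sum-δ (λ r → X r y) s) (sumℤ-*ˡ (- δ â y) (λ r → v r * [m∣ + 2 * κ r - κ s ]))))

      o-ι : ∀ i → δ o (ι i) ≡ 0ℤ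
      o-ι i = δ-off {i = o} {j = ι i} fromℕ≢inject₁

      ι-o : ∀ i → δ (ι i) o ≡ 0ℤ
      ι-o i = δ-off {i = ι i} {j = o} (λ e → fromℕ≢inject₁ (≡.sym e))

      ι-ι : ∀ i′ i → δ (ι i′) (ι i) ≡ δ i′ i
      ι-ι = δ-injective inject₁ inject₁-injective

      X-at-g : ∀ s i → X s (ι i) ≡ v s * δ a₀ i + u s i
      X-at-g s i = ≡.cong₂ _+_
        (≡.cong (v s *_) (≡.trans (≡.cong₂ _+_ (o-ι i) (ι-ι a₀ i)) (ℤP.+-identityˡ (δ a₀ i))))
        (≡.trans (sumℤ-cong (λ i′ → ≡.cong (u s i′ *_) (≡.trans (≡.cong₂ _-_ (ι-ι i′ i) (o-ι i)) (ℤP.+-identityʳ (δ i′ i)))))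
                 (sum-δ (u s) i))

      X-at-0 : ∀ s → X s o ≡ v s - sumℤ (u s)
      X-at-0 s = begin
        v s * (δ o o + δ â o) + sumℤ (λ i → u s i * (δ (ι i) o - δ o o))
          ≡⟨ ≡.cong₂ _+_ (≡.cong (v s *_) (≡.cong₂ _+_ (δ-diag o) (ι-o a₀)))
                         (sumℤ-cong (λ i → ≡.trans (≡.cong (λ z → u s i * (z - δ o o)) (ι-o i))
                                                   (≡.trans (≡.cong (λ z → u s i * (0ℤ - z)) (δ-diag o))
                                                            (ℤP.*-comm (u s i) (- 1ℤ))))) ⟩
        v s * (1ℤ + 0ℤ) + sumℤ (λ i → - 1ℤ * u s i)
          ≡⟨ ≡.cong (_+_ (v s * (1ℤ + 0ℤ))) (sumℤ-*ˡ (- 1ℤ) (u s)) ⟩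
        v s * (1ℤ + 0ℤ) + - 1ℤ * sumℤ (u s)
          ≡⟨ tidy (v s) (sumℤ (u s)) ⟩
        v s - sumℤ (u s) ∎
        where
        open ≡.≡-Reasoning
        tidy : ∀ a b → a * (1ℤ + 0ℤ) + - 1ℤ * b ≡ a - b
        tidy = solve-∀

    -- On the shifted coordinates the family B is independent: the equations
    -- at (κ s, gᵢ) and at (κ s, 0) force 2 v s = S s, rigidity gives v = 0,
    -- and then all u vanish.
    B-indep : DoublingRigid → IndepOn₂ Shifted B
    B-indep rigid c rel = coefficient-zero
      where
      open Coefficients c
      vanish : ∀ s y → X s y + (- δ â y) * S s ≡ 0ℤ
      vanish s y = ≡.trans (≡.sym (combination-at s y)) (rel (ρ (κ s) y) (s , y , ≡.refl))
      u≡ : ∀ s i → u s i ≡ (S s - v s) * δ a₀ i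
      u≡ s i = ≡.trans (isolate (v s) (δ a₀ i) (u s i) (S s))
                       (≡.trans (≡.cong (_+_ ((S s - v s) * δ a₀ i)) at-g) (ℤP.+-identityʳ _))
        where
        at-g : v s * δ a₀ i + u s i + (- δ a₀ i) * S s ≡ 0ℤ
        at-g = ≡.trans (≡.cong₂ (λ x d → x + (- d) * S s) (≡.sym (X-at-g s i)) (≡.sym (ι-ι a₀ i))) (vanish s (ι i))
        isolate : ∀ a d x b → x ≡ (b - a) * d + (a * d + x + (- d) * b)
        isolate = solve-∀
      v-sum : ∀ s → v s - sumℤ (u s) ≡ 0ℤ
      v-sum s = ≡.trans (≡.sym (X-at-0 s))
                  (≡.trans (≡.sym (ℤP.+-identityʳ (X s o)))
                           (≡.trans (≡.cong (λ d → X s o + (- d) * S s) (≡.sym (ι-o a₀))) (vanish s o)))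
      doubling : ∀ s → + 2 * v s ≡ S s
      doubling s = ≡.trans (solve-for (v s) (S s)) (≡.trans (≡.cong (_+_ (S s)) balance) (ℤP.+-identityʳ (S s)))
        where
        Σu≡ : sumℤ (u s) ≡ S s - v s
        Σu≡ = ≡.trans (sumℤ-cong (u≡ s)) (sum-δ′ (λ _ → S s - v s) a₀)
        balance : v s - (S s - v s) ≡ 0ℤ
        balance = ≡.trans (≡.cong (_-_ (v s)) (≡.sym Σu≡)) (v-sum s)
        solve-for : ∀ a b → + 2 * a ≡ b + (a - (b - a))
        solve-for = solve-∀
      v≡0 : ∀ r → v r ≡ 0ℤ
      v≡0 = rigid v doubling
      S≡0 : ∀ s → S s ≡ 0ℤ
      S≡0 s = sumℤ-zero (λ r → ≡.cong (_* [m∣ + 2 * κ r - κ s ]) (v≡0 r))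
      coefficient-zero : ∀ r x → c r x ≡ 0ℤ
      coefficient-zero r zero    = v≡0 r
      coefficient-zero r (suc i) =
        ≡.trans (u≡ r i) (≡.cong (_* δ a₀ i) (≡.cong₂ _-_ (S≡0 r) (v≡0 r)))

-- Well-roundedness from a family whose size equals n only propositionally.
well-rounded-intro : ∀ {A : AbelianGroup 0ℓ 0ℓ} (L : Listing A) {D} → D ≡ Listing.n L →
  (v : Fin D → Fin (suc (Listing.n L)) → ℤ) → (∀ t → IsMinimalVector L (v t)) → LinIndep v → WellRounded L
well-rounded-intro L ≡.refl v v-min v-indep = v , v-min , v-indep

product-well-rounded : ∀ R → Residues.DoublingRigid R →
  (G : AbelianGroup 0ℓ 0ℓ) (LG : Listing G) → WellRounded LG → MinDist LG 2 →
  (LH : Listing (suc R ⊗ G)) → WellRounded LH × MinDist LH 2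
product-well-rounded R rigid G LG (w , w-min , w-indep) d₂ LH =
  well-rounded-intro LH (ℕP.suc-injective (≡.sym order)) family family-minimal family-indep , dH₂
  where
  open Construction R G LG LH
  dH₂ : MinDist LH 2
  dH₂ = let ((X , X∈𝓛 , X≢0 , ‖X‖²≡4) , _) = d₂ in
    𝓛H.min-dist-2 (W X) (W-in-lattice X X∈𝓛) (W-nonzero X X≢0) (≡.trans (W-norm X) ‖X‖²≡4)
  a₀ : Fin nG
  a₀ = let ((X , X∈𝓛 , X≢0 , _) , _) = d₂ in nonzero⇒positive-rank X (proj₁ X∈𝓛) X≢0
  open Shifted-block a₀
  minimal : ∀ Y → InLattice LH Y → ‖ Y ‖² ≡ + 4 → IsMinimalVector LH Y
  minimal Y Y∈𝓛 ‖Y‖²≡4 = + 4 , dH₂ , Y∈𝓛 , ‖Y‖²≡4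
  w-norm : ∀ a → ‖ w a ‖² ≡ + 4
  w-norm a = let (δ , δ-min , _ , ‖wa‖²≡δ) = w-min a in ≡.trans ‖wa‖²≡δ (𝓛G.min-unique δ-min d₂)
  B-minimal : ∀ r x → IsMinimalVector LH (B r x)
  B-minimal r zero    = minimal (B r zero) (V-in-lattice a₀ (κ r)) (norm-quad (V-distinct a₀ (κ-nonzero r)))
  B-minimal r (suc i) = minimal (B r (suc i)) (U-in-lattice (κ r) i) (norm-quad (U-distinct i (κ-nonzero r)))
  family : Fin (nG ℕ.+ R ℕ.* suc nG) → Fin (suc N) → ℤ
  family = (λ a → W (w a)) ++ (λ t → uncurry B (remQuot {R} (suc nG) t))
  family-minimal : ∀ t → IsMinimalVector LH (family t)
  family-minimal = ++-all (IsMinimalVector LH) _ _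
    (λ a → minimal (W (w a)) (W-in-lattice (w a) (proj₁ (proj₂ (proj₂ (w-min a))))) (≡.trans (W-norm (w a)) (w-norm a)))
    (λ t → B-minimal (proj₁ (remQuot {R} (suc nG) t)) (proj₂ (remQuot {R} (suc nG) t)))
  family-indep : LinIndep family
  family-indep = append-indep (λ a → W (w a)) (λ t → uncurry B (remQuot {R} (suc nG) t))
    (embed-indep w (ρ 0ℤ) ρ₀-injective w-indep) (λ a → W-vanishes (w a)) (uncurry-indep B (B-indep rigid))

private
  halve : ∀ {a} → + 2 * a ≡ 0ℤ → a ≡ 0ℤ
  halve {a} 2a≡0 = ℤP.*-cancelˡ-≡ (+ 2) a 0ℤ 2a≡0

  third : ∀ {a} → + 3 * a ≡ 0ℤ → a ≡ 0ℤ
  third {a} 3a≡0 = ℤP.*-cancelˡ-≡ (+ 3) a 0ℤ 3a≡0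

-- m = 2: the system is 2a = 0.
doubling-rigid-2 : Residues.DoublingRigid 1
doubling-rigid-2 v system zero = halve (≡.trans (system zero) (vanish (v zero)))
  where
  vanish : ∀ a → a * 0ℤ + 0ℤ ≡ 0ℤ
  vanish = solve-∀

-- m = 3: the system is 2a = b, 2b = a, so 3a = 2·2a - a = 2b - a = 0.
doubling-rigid-3 : Residues.DoublingRigid 2
doubling-rigid-3 v system = solution
  where
  a b : ℤ
  a = v zero
  b = v (suc zero)
  eq₁ : + 2 * a ≡ a * 0ℤ + (b * 1ℤ + 0ℤ)
  eq₁ = system zero
  eq₂ : + 2 * b ≡ a * 1ℤ + (b * 0ℤ + 0ℤ)
  eq₂ = system (suc zero)
  a≡0 : a ≡ 0ℤ
  a≡0 = third (begin
    + 3 * a                             ≡⟨ triple a ⟩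
    + 2 * (+ 2 * a) - a                 ≡⟨ ≡.cong (λ z → + 2 * z - a) eq₁ ⟩
    + 2 * (a * 0ℤ + (b * 1ℤ + 0ℤ)) - a  ≡⟨ simplify a b ⟩
    + 2 * b - a                         ≡⟨ ≡.cong (_- a) eq₂ ⟩
    a * 1ℤ + (b * 0ℤ + 0ℤ) - a          ≡⟨ cancel a b ⟩
    0ℤ                                  ∎)
    where
    open ≡.≡-Reasoning
    triple : ∀ a → + 3 * a ≡ + 2 * (+ 2 * a) - a
    triple = solve-∀
    simplify : ∀ a b → + 2 * (a * 0ℤ + (b * 1ℤ + 0ℤ)) - a ≡ + 2 * b - a
    simplify = solve-∀
    cancel : ∀ a b → a * 1ℤ + (b * 0ℤ + 0ℤ) - a ≡ 0ℤ
    cancel = solve-∀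
  b≡0 : b ≡ 0ℤ
  b≡0 = halve (≡.trans eq₂ (≡.trans (≡.cong (λ z → z * 1ℤ + (b * 0ℤ + 0ℤ)) a≡0) (vanish b)))
    where
    vanish : ∀ b → 0ℤ * 1ℤ + (b * 0ℤ + 0ℤ) ≡ 0ℤ
    vanish = solve-∀
  solution : ∀ r → v r ≡ 0ℤ
  solution zero       = a≡0
  solution (suc zero) = b≡0

-- m = 4: the system is 2a = 0, 2b = a + c, 2c = 0.
doubling-rigid-4 : Residues.DoublingRigid 3
doubling-rigid-4 v system = solution
  where
  a b c : ℤ
  a = v zero
  b = v (suc zero)
  c = v (suc (suc zero))
  eq₁ : + 2 * a ≡ a * 0ℤ + (b * 0ℤ + (c * 0ℤ + 0ℤ))
  eq₁ = system zero
  eq₂ : + 2 * b ≡ a * 1ℤ + (b * 0ℤ + (c * 1ℤ + 0ℤ))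
  eq₂ = system (suc zero)
  eq₃ : + 2 * c ≡ a * 0ℤ + (b * 0ℤ + (c * 0ℤ + 0ℤ))
  eq₃ = system (suc (suc zero))
  vanish : ∀ a b c → a * 0ℤ + (b * 0ℤ + (c * 0ℤ + 0ℤ)) ≡ 0ℤ
  vanish = solve-∀
  a≡0 : a ≡ 0ℤ
  a≡0 = halve (≡.trans eq₁ (vanish a b c))
  c≡0 : c ≡ 0ℤ
  c≡0 = halve (≡.trans eq₃ (vanish a b c))
  b≡0 : b ≡ 0ℤ
  b≡0 = halve (≡.trans eq₂ (≡.trans (≡.cong₂ (λ x z → x * 1ℤ + (b * 0ℤ + (z * 1ℤ + 0ℤ))) a≡0 c≡0) (vanish′ b)))
    where
    vanish′ : ∀ b → 0ℤ * 1ℤ + (b * 0ℤ + (0ℤ * 1ℤ + 0ℤ)) ≡ 0ℤ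
    vanish′ = solve-∀
  solution : ∀ r → v r ≡ 0ℤ
  solution zero             = a≡0
  solution (suc zero)       = b≡0
  solution (suc (suc zero)) = c≡0

lemma4p2 : (m : ℕ) → (m ≡ 2 ⊎ m ≡ 3 ⊎ m ≡ 4) →
    (G : AbelianGroup 0ℓ 0ℓ) (LG : Listing G) →
    WellRounded LG → MinDist LG 2 →
    (LmG : Listing (m ⊗ G)) →
    WellRounded LmG × MinDist LmG 2
lemma4p2 _ (inj₁ ≡.refl)        = product-well-rounded 1 doubling-rigid-2
lemma4p2 _ (inj₂ (inj₁ ≡.refl)) = product-well-rounded 2 doubling-rigid-3
lemma4p2 _ (inj₂ (inj₂ ≡.refl)) = product-well-rounded 3 doubling-rigid-4
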